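{- Let $r\ge2$ and let $\mathcal{P}$ be a set of $r$-patterns such that the family of all $\mathcal{P}$-cliques is reconstructible. Then there is a constant $C>0$ such that a.a.s.\ $z_{\mathcal{P}}(\mathbb{RM}^{(r)}_{n})\le C n^{1/r}$, i.e., $z_{\mathcal{P}}(\mathbb{RM}^{(r)}_n)=O(n^{1/r})$ a.a.s.
   Context: An ordered $r$-matching is a set of pairwise disjoint $r$-element subsets (edges) of a linearly ordered vertex set (no isolated vertices). An $r$-pattern is an ordered $r$-matching of size $2$ up to order-isomorphism. For a set $\mathcal{P}$ of $r$-patterns, a $\mathcal{P}$-clique is an ordered $r$-matching every pair of whose edges forms a pattern in $\mathcal{P}$; $z_{\mathcal{P}}(M)$ is the largest size of a $\mathcal{P}$-clique that is a sub-matching of $M$. The trace $\mathrm{tr}(M)$ of an ordered $r$-matching $M$ is the word over alphabet $[r]$ obtained by reading the vertices in order and writing $i$ at each vertex that is the $i$-th (from the left) vertex of its edge. A family $\mathcal{F}$ of ordered $r$-matchings is reconstructible if no two distinct members of $\mathcal{F}$ on the same ordered vertex set have the same trace. $\mathbb{RM}^{(r)}_{n}$ is a uniformly random ordered $r$-matching on $[rn]$; a.a.s.\ means with probability tending to $1$ as $n\to\infty$. -}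

module Defs where

open import Data.Bool using (Bool; true; false; _∧_; _∨_; if_then_else_)
open import Data.Nat using (ℕ; zero; suc; _+_; _*_; _^_; _≤_; _<_; _⊔_; _≡ᵇ_; _<ᵇ_)
open import Data.List using (List; []; _∷_; _++_; map; length; foldr; upTo; concatMap)
open import Data.Product using (Σ; _×_)
open import Relation.Binary.PropositionalEquality using (_≡_)

bfilter : {A : Set} → (A → Bool) → List A → List A
bfilter p [] = []
bfilter p (x ∷ xs) = if p x then x ∷ bfilter p xs else bfilter p xs

ball : {A : Set} → (A → Bool) → List A → Bool
ball p [] = true
ball p (x ∷ xs) = p x ∧ ball p xs

countℕ : ℕ → List ℕ → ℕ
countℕ x xs = length (bfilter (x ≡ᵇ_) xs)

words : ℕ → ℕ → List (List ℕ)
words m zero = [] ∷ []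
words m (suc L) = concatMap (λ x → map (x ∷_) (words m L)) (upTo m)

-- Restricted growth: labels appear for the first time in order 0,1,2,…
rg : ℕ → List ℕ → Bool
rg k [] = true
rg k (x ∷ xs) = if x <ᵇ k then rg k xs else (if x ≡ᵇ k then rg (suc k) xs else false)

-- An ordered r-matching with m edges on the vertex set [r m] (= positions
-- 0,…,rm-1 of the word) is encoded canonically by the word w whose i-th
-- letter is the label of the edge containing vertex i, edges being labelled
-- 0,…,m-1 in the order of their leftmost vertices.  Each ordered r-matching
-- on [rm] has exactly one such encoding.
isMatching : ℕ → ℕ → List ℕ → Bool
isMatching r m w =
  (length w ≡ᵇ r * m) ∧ rg 0 w ∧ ball (_<ᵇ m) w ∧ ball (λ j → countℕ j w ≡ᵇ r) (upTo m)

-- All ordered r-matchings on [r n] (sample space of RM^(r)_n, uniform measure)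
matchings : ℕ → ℕ → List (List ℕ)
matchings r n = bfilter (isMatching r n) (words n (r * n))

-- The r-pattern formed by edges a and b of w: the word of length 2r obtained
-- by reading the vertices of the two edges in order and writing true for the
-- vertices of the edge containing the leftmost vertex, false otherwise.
-- (This is the canonical representative of the order-isomorphism class.)
pattern2 : List ℕ → ℕ → ℕ → List Bool
pattern2 w a b with bfilter (λ x → (x ≡ᵇ a) ∨ (x ≡ᵇ b)) w
... | [] = []
... | h ∷ v = map (λ x → x ≡ᵇ h) (h ∷ v)

allPairs : (ℕ → ℕ → Bool) → List ℕ → Bool
allPairs f [] = true
allPairs f (x ∷ xs) = ball (f x) xs ∧ allPairs f xs

PatternSet : Set
PatternSet = List Bool → Bool

isCliqueOn : PatternSet → List ℕ → List ℕ → Bool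
isCliqueOn P w S = allPairs (λ a b → P (pattern2 w a b)) S

isClique : PatternSet → ℕ → List ℕ → Bool
isClique P m w = isCliqueOn P w (upTo m)

subs : List ℕ → List (List ℕ)
subs [] = [] ∷ []
subs (x ∷ xs) = subs xs ++ map (x ∷_) (subs xs)

zP : PatternSet → ℕ → List ℕ → ℕ
zP P n w = foldr _⊔_ 0 (map length (bfilter (isCliqueOn P w) (subs (upTo n))))

-- trace: at each vertex write i if it is the i-th vertex of its edge (i ∈ [r])
traceAux : List ℕ → List ℕ → List ℕ
traceAux seen [] = []
traceAux seen (x ∷ xs) = suc (countℕ x seen) ∷ traceAux (x ∷ seen) xs

trace : List ℕ → List ℕ
trace w = traceAux [] w

-- Up to order-isomorphism every ordered vertex set of a matching with m edges
-- is [r m], so it suffices to quantify over canonical encodings on [r m].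
Reconstructible : ℕ → PatternSet → Set
Reconstructible r P =
  ∀ (m : ℕ) (w₁ w₂ : List ℕ) →
  isMatching r m w₁ ≡ true → isMatching r m w₂ ≡ true →
  isClique P m w₁ ≡ true → isClique P m w₂ ≡ true →
  trace w₁ ≡ trace w₂ → w₁ ≡ w₂

total : ℕ → ℕ → ℕ
total r n = length (matchings r n)

-- number of ordered r-matchings M on [r n] with z_P(M) > C n^{1/r},
-- i.e. z_P(M)^r > C^r n
badCount : ℕ → PatternSet → ℕ → ℕ → ℕ
badCount r P C n =
  length (bfilter (λ w → (C ^ r) * n <ᵇ (zP P n w) ^ r) (matchings r n))

-- a.a.s. z_P(RM^(r)_n) ≤ C n^{1/r}: for every ε = 1/(k+1) there is N such that
-- for n ≥ N, Pr[z_P > C n^{1/r}] < ε.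
AAS-bounded : ℕ → PatternSet → ℕ → Set
AAS-bounded r P C =
  ∀ (k : ℕ) → Σ ℕ λ N → ∀ (n : ℕ) → N ≤ n → suc k * badCount r P C n < total r n

{-# OPTIONS --safe #-}

-- Double counting.  Put C = 8 (r + 1) and let μ be least with μ ^ r > C ^ r n, so that every bad
-- matching w (z_P(w) ^ r > C ^ r n) contains a P-clique S of exactly μ edges.  Replace the edges
-- of S by any of the (μ !) ^ r labelled r-matchings y on the same vertices that concatenate r
-- permutations of [μ].  The pair (w , y) is determined by the resulting matching, the labels its
-- μ new edges receive (at most n ^ μ choices) and the trace of S (at most (r + 1) ^ (r μ)
-- choices): the new edges and the rest of w can be read off, and S is recovered from its trace
-- because P-cliques are reconstructible.  Hence
--   #bad · (μ !) ^ r ≤ #all · n ^ μ · (r + 1) ^ (r μ),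
-- and the estimate μ ^ μ ≤ 4 ^ μ μ ! makes the last two factors smaller than (μ !) ^ r / n:
-- fewer than a fraction 1/n of all matchings are bad.

module Submission where

open import Defs
open import Data.Bool using (Bool; true; false; _∧_; _∨_; not; if_then_else_)
open import Data.Bool.Properties using (∨-comm)
open import Data.Empty using (⊥-elim)
open import Data.List
  using (List; []; _∷_; _++_; [_]; map; length; upTo; applyUpTo; take; concatMap;
         cartesianProductWith; cartesianProduct)
open import Data.List.Properties
  using (length-++; length-map; map-id; map-∘; map-++; map-cong-local; length-upTo; length-take;
         ∷-injective; ∷-injectiveˡ; ∷-injectiveʳ; ++-assoc; ++-identityʳ; upTo-∷ʳ)
open import Data.List.Membership.Propositional using (_∈_; _∉_)
open import Data.List.Membership.Propositional.Properties
  using (∈-map⁺; ∈-map⁻; ∈-++⁺ˡ; ∈-++⁺ʳ; ∈-++⁻; ∈-cartesianProductWith⁺;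
         ∈-cartesianProductWith⁻; ∈-cartesianProduct⁺; ∈-cartesianProduct⁻; ∈-upTo⁺; ∈-upTo⁻;
         ∈-length; foldr-selective)
open import Data.List.Relation.Binary.Subset.Propositional using (_⊆_)
open import Data.List.Relation.Unary.All as All using (All; []; _∷_)
open import Data.List.Relation.Unary.All.Properties using () renaming (++⁺ to All++⁺)
open import Data.List.Relation.Unary.AllPairs using ([]; _∷_)
open import Data.List.Relation.Unary.Any using (here; there)
open import Data.List.Relation.Unary.Unique.Propositional using (Unique)
open import Data.List.Relation.Unary.Unique.Propositional.Properties using (upTo⁺; cartesianProduct⁺)
  renaming (++⁺ to Unique-++⁺)
open import Data.Nat
  using (ℕ; zero; suc; _+_; _*_; _^_; _≤_; _<_; _≡ᵇ_; _<ᵇ_; z≤n; s≤s; s≤s⁻¹;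
         NonZero; >-nonZero; >-nonZero⁻¹; _!)
open import Data.Nat.Properties
open import Data.Nat.Solver using (module +-*-Solver)
open import Data.List.Membership.DecPropositional _≟_ using (_∈?_)
open import Data.Product using (Σ; ∃; _×_; _,_; proj₁; proj₂)
open import Data.Sum using (_⊎_; inj₁; inj₂; [_,_]′)
open import Function using (_∘_; id)
open import Relation.Binary.PropositionalEquality
  using (_≡_; _≢_; refl; sym; trans; cong; cong₂; subst; module ≡-Reasoning)
open import Relation.Nullary using (¬_; Dec; does; yes; no)
open import Relation.Nullary.Decidable using (dec-true; dec-false)

private variable
  A B C : Set

InjectiveOn : (A → B) → List A → Set
InjectiveOn f xs = ∀ {x y} → x ∈ xs → y ∈ xs → f x ≡ f y → x ≡ y

remove : {x : A} {ys : List A} → x ∈ ys → List A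
remove {ys = _ ∷ ys} (here _) = ys
remove {ys = y ∷ _} (there p) = y ∷ remove p

length-remove : {x : A} {ys : List A} (p : x ∈ ys) → length ys ≡ suc (length (remove p))
length-remove (here _) = refl
length-remove (there p) = cong suc (length-remove p)

∈-remove : {x z : A} {ys : List A} (p : x ∈ ys) → z ∈ ys → z ≢ x → z ∈ remove p
∈-remove (here refl) (here refl) z≢x = ⊥-elim (z≢x refl)
∈-remove (here refl) (there q) _ = q
∈-remove (there p) (here refl) _ = here refl
∈-remove (there p) (there q) z≢x = there (∈-remove p q z≢x)

Unique-∉ : {x : A} {xs : List A} → Unique (x ∷ xs) → x ∉ xs
Unique-∉ (x≢ ∷ _) x∈xs = All.lookup x≢ x∈xs refl

injectiveOn⇒length≤ : (f : A → B) {xs : List A} {ys : List B} → Unique xs →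
  (∀ {x} → x ∈ xs → f x ∈ ys) → InjectiveOn f xs → length xs ≤ length ys
injectiveOn⇒length≤ f {[]} _ _ _ = z≤n
injectiveOn⇒length≤ f {x ∷ xs} {ys} u@(_ ∷ uxs) into inj = begin
  suc (length xs)               ≤⟨ s≤s (injectiveOn⇒length≤ f uxs into′ (λ p q → inj (there p) (there q))) ⟩
  suc (length (remove fx∈ys))   ≡⟨ length-remove fx∈ys ⟨
  length ys                     ∎
  where
  open ≤-Reasoning
  fx∈ys : f x ∈ ys
  fx∈ys = into (here refl)
  into′ : ∀ {z} → z ∈ xs → f z ∈ remove fx∈ys
  into′ z∈xs = ∈-remove fx∈ys (into (there z∈xs))
    (λ fz≡fx → Unique-∉ u (subst (_∈ xs) (inj (there z∈xs) (here refl) fz≡fx) z∈xs))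

length-cartesianProductWith : (g : A → B → C) (xs : List A) (ys : List B) →
  length (cartesianProductWith g xs ys) ≡ length xs * length ys
length-cartesianProductWith g [] ys = refl
length-cartesianProductWith g (x ∷ xs) ys = begin
  length (map (g x) ys ++ cartesianProductWith g xs ys)      ≡⟨ length-++ (map (g x) ys) ⟩
  length (map (g x) ys) + length (cartesianProductWith g xs ys)
    ≡⟨ cong₂ _+_ (length-map (g x) ys) (length-cartesianProductWith g xs ys) ⟩
  length ys + length xs * length ys                          ∎
  where open ≡-Reasoning

Unique-map⁺ : (f : A → B) {xs : List A} → InjectiveOn f xs → Unique xs → Unique (map f xs)
Unique-map⁺ f {[]} _ [] = []
Unique-map⁺ f {x ∷ xs} inj u@(_ ∷ uxs) =
  All.tabulate fresh ∷ Unique-map⁺ f (λ p q → inj (there p) (there q)) uxs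
  where
  fresh : ∀ {z} → z ∈ map f xs → f x ≢ z
  fresh z∈ fx≡z with ∈-map⁻ f z∈
  ... | y , y∈xs , refl = Unique-∉ u (subst (_∈ xs) (sym (inj (here refl) (there y∈xs) fx≡z)) y∈xs)

Unique-cartesianProductWith⁺ : (g : A → B → C) {xs : List A} {ys : List B} →
  Unique xs → Unique ys →
  (∀ {a a′ b b′} → a ∈ xs → a′ ∈ xs → b ∈ ys → b′ ∈ ys → g a b ≡ g a′ b′ → a ≡ a′ × b ≡ b′) →
  Unique (cartesianProductWith g xs ys)
Unique-cartesianProductWith⁺ g {[]} _ _ _ = []
Unique-cartesianProductWith⁺ g {x ∷ xs} {ys} ux@(_ ∷ uxs) uys inj =
  Unique-++⁺ (Unique-map⁺ (g x) (λ p q e → proj₂ (inj (here refl) (here refl) p q e)) uys)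
             (Unique-cartesianProductWith⁺ g uxs uys (λ p q → inj (there p) (there q)))
             disjoint
  where
  disjoint : ∀ {v} → ¬ (v ∈ map (g x) ys × v ∈ cartesianProductWith g xs ys)
  disjoint (p , q) with ∈-map⁻ (g x) p | ∈-cartesianProductWith⁻ g xs ys q
  ... | b , b∈ , refl | a , b′ , a∈ , b′∈ , e =
    Unique-∉ ux (subst (_∈ xs) (sym (proj₁ (inj (here refl) (there a∈) b∈ b′∈ e))) a∈)

∈-take : ∀ k {xs : List A} {z} → z ∈ take k xs → z ∈ xs
∈-take (suc k) {_ ∷ _} (here e) = here e
∈-take (suc k) {_ ∷ _} (there p) = there (∈-take k p)

map-cong-∈ : (f g : A → B) (xs : List A) → (∀ {x} → x ∈ xs → f x ≡ g x) → map f xs ≡ map g xs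
map-cong-∈ f g xs h = map-cong-local (All.tabulate h)

map-≡⇒pointwise : (f g : A → B) (xs : List A) → map f xs ≡ map g xs → ∀ {x} → x ∈ xs → f x ≡ g x
map-≡⇒pointwise f g (_ ∷ xs) e (here refl) = ∷-injectiveˡ e
map-≡⇒pointwise f g (_ ∷ xs) e (there p) = map-≡⇒pointwise f g xs (∷-injectiveʳ e) p

does-true : {P : Set} (p? : Dec P) → does p? ≡ true → P
does-true (yes p) _ = p

does-false : {P : Set} (p? : Dec P) → does p? ≡ false → ¬ P
does-false (no ¬p) _ = ¬p

∧-true : ∀ {a b} → a ∧ b ≡ true → a ≡ true × b ≡ true
∧-true {true} {true} _ = refl , refl

∈-bfilter⁻ : (p : A → Bool) {x : A} (xs : List A) → x ∈ bfilter p xs → x ∈ xs × p x ≡ true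
∈-bfilter⁻ p (y ∷ xs) x∈ with p y in py | x∈
... | true | here refl = here refl , py
... | true | there x∈′ = let x∈xs , px = ∈-bfilter⁻ p xs x∈′ in there x∈xs , px
... | false | x∈′ = let x∈xs , px = ∈-bfilter⁻ p xs x∈′ in there x∈xs , px

∈-bfilter⁺ : (p : A → Bool) {x : A} {xs : List A} → x ∈ xs → p x ≡ true → x ∈ bfilter p xs
∈-bfilter⁺ p {xs = y ∷ xs} (here refl) px rewrite px = here refl
∈-bfilter⁺ p {xs = y ∷ xs} (there x∈) px with p y
... | true = there (∈-bfilter⁺ p x∈ px)
... | false = ∈-bfilter⁺ p x∈ px

Unique-bfilter : (p : A → Bool) {xs : List A} → Unique xs → Unique (bfilter p xs)
Unique-bfilter p {[]} [] = []
Unique-bfilter p {y ∷ xs} (y∉ ∷ u) with p y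
... | true = All.tabulate (λ x∈ → All.lookup y∉ (proj₁ (∈-bfilter⁻ p xs x∈))) ∷ Unique-bfilter p u
... | false = Unique-bfilter p u

bfilter-cong : (p q : A → Bool) (xs : List A) → (∀ {x} → x ∈ xs → p x ≡ q x) → bfilter p xs ≡ bfilter q xs
bfilter-cong p q [] _ = refl
bfilter-cong p q (x ∷ xs) p≗q rewrite p≗q (here refl) with q x
... | true = cong (x ∷_) (bfilter-cong p q xs (p≗q ∘ there))
... | false = bfilter-cong p q xs (p≗q ∘ there)

bfilter-all : (p : A → Bool) (xs : List A) → (∀ {x} → x ∈ xs → p x ≡ true) → bfilter p xs ≡ xs
bfilter-all p [] _ = refl
bfilter-all p (x ∷ xs) all-p rewrite all-p (here refl) = cong (x ∷_) (bfilter-all p xs (all-p ∘ there))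

bfilter-map : (q : B → Bool) (f : A → B) (xs : List A) → bfilter q (map f xs) ≡ map f (bfilter (q ∘ f) xs)
bfilter-map q f [] = refl
bfilter-map q f (x ∷ xs) with q (f x)
... | true = cong (f x ∷_) (bfilter-map q f xs)
... | false = bfilter-map q f xs

bfilter-bfilter : (p q : A → Bool) (xs : List A) → (∀ x → q x ≡ true → p x ≡ true) →
  bfilter q (bfilter p xs) ≡ bfilter q xs
bfilter-bfilter p q [] _ = refl
bfilter-bfilter p q (x ∷ xs) q⇒p with p x in px | q x in qx
... | true | true rewrite qx = cong (x ∷_) (bfilter-bfilter p q xs q⇒p)
... | true | false rewrite qx = bfilter-bfilter p q xs q⇒p
... | false | false = bfilter-bfilter p q xs q⇒p
... | false | true with () ← trans (sym (q⇒p x qx)) px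

length-bfilter-∨ : (p q : A → Bool) (xs : List A) → (∀ {x} → x ∈ xs → p x ≡ true → q x ≡ false) →
  length (bfilter (λ x → p x ∨ q x) xs) ≡ length (bfilter p xs) + length (bfilter q xs)
length-bfilter-∨ p q [] _ = refl
length-bfilter-∨ p q (x ∷ xs) excl with p x in px
... | true rewrite excl (here refl) px = cong suc (length-bfilter-∨ p q xs (excl ∘ there))
... | false with q x
...   | true = trans (cong suc (length-bfilter-∨ p q xs (excl ∘ there))) (sym (+-suc _ _))
...   | false = length-bfilter-∨ p q xs (excl ∘ there)

ball-true⇒ : (p : A → Bool) {xs : List A} → ball p xs ≡ true → ∀ {x} → x ∈ xs → p x ≡ true
ball-true⇒ p {y ∷ _} all-p (here refl) = proj₁ (∧-true {p y} all-p)
ball-true⇒ p {y ∷ _} all-p (there x∈) = ball-true⇒ p (proj₂ (∧-true {p y} all-p)) x∈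

ball-true⇐ : (p : A → Bool) (xs : List A) → (∀ {x} → x ∈ xs → p x ≡ true) → ball p xs ≡ true
ball-true⇐ p [] _ = refl
ball-true⇐ p (y ∷ xs) all-p rewrite all-p (here refl) = ball-true⇐ p xs (all-p ∘ there)

allPairs-true⇒ : (f : ℕ → ℕ → Bool) (xs : List ℕ) → allPairs f xs ≡ true →
  ∀ {a b} → a ∈ xs → b ∈ xs → a ≢ b → f a b ≡ true ⊎ f b a ≡ true
allPairs-true⇒ f (x ∷ xs) _ (here refl) (here refl) a≢b = ⊥-elim (a≢b refl)
allPairs-true⇒ f (x ∷ xs) fs (here refl) (there b∈) _ = inj₁ (ball-true⇒ (f x) (proj₁ (∧-true {ball (f x) xs} fs)) b∈)
allPairs-true⇒ f (x ∷ xs) fs (there a∈) (here refl) _ = inj₂ (ball-true⇒ (f x) (proj₁ (∧-true {ball (f x) xs} fs)) a∈)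
allPairs-true⇒ f (x ∷ xs) fs (there a∈) (there b∈) a≢b =
  allPairs-true⇒ f xs (proj₂ (∧-true {ball (f x) xs} fs)) a∈ b∈ a≢b

allPairs-true⇐ : (f : ℕ → ℕ → Bool) (xs : List ℕ) → Unique xs →
  (∀ {a b} → a ∈ xs → b ∈ xs → a ≢ b → f a b ≡ true) → allPairs f xs ≡ true
allPairs-true⇐ f [] _ _ = refl
allPairs-true⇐ f (x ∷ xs) u@(_ ∷ uxs) fs
  rewrite ball-true⇐ (f x) xs (λ b∈ → fs (here refl) (there b∈) (λ { refl → Unique-∉ u b∈ })) =
  allPairs-true⇐ f xs uxs (λ a∈ b∈ → fs (there a∈) (there b∈))

allPairs-take : (f : ℕ → ℕ → Bool) (k : ℕ) (xs : List ℕ) → allPairs f xs ≡ true → allPairs f (take k xs) ≡ true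
allPairs-take f zero xs _ = refl
allPairs-take f (suc k) [] _ = refl
allPairs-take f (suc k) (x ∷ xs) fs with ∧-true {ball (f x) xs} fs
... | fx , fxs rewrite ball-true⇐ (f x) (take k xs) (ball-true⇒ (f x) fx ∘ ∈-take k) = allPairs-take f k xs fxs

words-suc : ∀ m L → words m (suc L) ≡ cartesianProductWith _∷_ (upTo m) (words m L)
words-suc m L = concatMap-map (upTo m)
  where
  concatMap-map : ∀ xs → concatMap (λ x → map (x ∷_) (words m L)) xs ≡ cartesianProductWith _∷_ xs (words m L)
  concatMap-map [] = refl
  concatMap-map (x ∷ xs) = cong (map (x ∷_) (words m L) ++_) (concatMap-map xs)

length-words : ∀ m L → length (words m L) ≡ m ^ L
length-words m zero = refl
length-words m (suc L) = begin
  length (words m (suc L))                                    ≡⟨ cong length (words-suc m L) ⟩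
  length (cartesianProductWith _∷_ (upTo m) (words m L))      ≡⟨ length-cartesianProductWith _∷_ (upTo m) (words m L) ⟩
  length (upTo m) * length (words m L)                        ≡⟨ cong₂ _*_ (length-upTo m) (length-words m L) ⟩
  m * m ^ L                                                   ∎
  where open ≡-Reasoning

Unique-words : ∀ m L → Unique (words m L)
Unique-words m zero = [] ∷ []
Unique-words m (suc L) = subst Unique (sym (words-suc m L))
  (Unique-cartesianProductWith⁺ _∷_ (upTo⁺ m) (Unique-words m L) (λ _ _ _ _ → ∷-injective))

∈-words : ∀ m (v : List ℕ) → All (_< m) v → v ∈ words m (length v)
∈-words m [] _ = here refl
∈-words m (x ∷ v) (x<m ∷ v<m) = subst (x ∷ v ∈_) (sym (words-suc m (length v)))
  (∈-cartesianProductWith⁺ _∷_ (∈-upTo⁺ x<m) (∈-words m v v<m))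

countℕ-++ : ∀ x xs ys → countℕ x (xs ++ ys) ≡ countℕ x xs + countℕ x ys
countℕ-++ x [] ys = refl
countℕ-++ x (y ∷ xs) ys with x ≡ᵇ y
... | true = cong suc (countℕ-++ x xs ys)
... | false = countℕ-++ x xs ys

countℕ-∉ : ∀ x xs → x ∉ xs → countℕ x xs ≡ 0
countℕ-∉ x [] _ = refl
countℕ-∉ x (y ∷ xs) x∉ with x ≡ᵇ y in x≡y
... | true = ⊥-elim (x∉ (here (does-true (x ≟ y) x≡y)))
... | false = countℕ-∉ x xs (x∉ ∘ there)

countℕ>0⇒∈ : ∀ x xs → 0 < countℕ x xs → x ∈ xs
countℕ>0⇒∈ x (y ∷ xs) pos with x ≡ᵇ y in x≡y
... | true = here (does-true (x ≟ y) x≡y)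
... | false = there (countℕ>0⇒∈ x xs pos)

countℕ-map : (f : ℕ → ℕ) (x : ℕ) (xs : List ℕ) → (∀ {y} → y ∈ xs → f y ≡ f x → y ≡ x) →
  countℕ (f x) (map f xs) ≡ countℕ x xs
countℕ-map f x [] _ = refl
countℕ-map f x (y ∷ xs) inj with x ≡ᵇ y in x≡y
... | true rewrite does-true (x ≟ y) x≡y | dec-true (f y ≟ f y) refl = cong suc (countℕ-map f y xs (inj ∘ there))
... | false rewrite dec-false (f x ≟ f y) (λ fx≡fy → does-false (x ≟ y) x≡y (sym (inj (here refl) (sym fx≡fy)))) =
  countℕ-map f x xs (inj ∘ there)

countℕ-bfilter : (p : ℕ → Bool) (x : ℕ) (w : List ℕ) → p x ≡ true → countℕ x (bfilter p w) ≡ countℕ x w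
countℕ-bfilter p x [] _ = refl
countℕ-bfilter p x (y ∷ w) px with p y in py | x ≡ᵇ y in x≡y
... | true | true rewrite x≡y = cong suc (countℕ-bfilter p x w px)
... | true | false rewrite x≡y = countℕ-bfilter p x w px
... | false | false = countℕ-bfilter p x w px
... | false | true rewrite does-true (x ≟ y) x≡y with () ← trans (sym px) py

record IsLabelledMatching (r m : ℕ) (w : List ℕ) : Set where
  field
    length≡ : length w ≡ r * m
    labels< : All (_< m) w
    count≡ : ∀ j → j < m → countℕ j w ≡ r

open IsLabelledMatching

isMatching-true⇒ : ∀ r m w → isMatching r m w ≡ true → rg 0 w ≡ true × IsLabelledMatching r m w
isMatching-true⇒ r m w match
  with len , match₁ ← ∧-true {length w ≡ᵇ r * m} match
  with rg-w , match₂ ← ∧-true {rg 0 w} match₁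
  with labels , counts ← ∧-true {ball (_<ᵇ m) w} match₂ =
  rg-w , record
    { length≡ = does-true (length w ≟ r * m) len
    ; labels< = All.tabulate (λ x∈ → does-true (_ <? m) (ball-true⇒ (_<ᵇ m) labels x∈))
    ; count≡ = λ j j<m → does-true (countℕ j w ≟ r) (ball-true⇒ (λ j → countℕ j w ≡ᵇ r) counts (∈-upTo⁺ j<m))
    }

isMatching-true⇐ : ∀ r m w → rg 0 w ≡ true → IsLabelledMatching r m w → isMatching r m w ≡ true
isMatching-true⇐ r m w rg-w lm
  rewrite dec-true (length w ≟ r * m) (length≡ lm) | rg-w
        | ball-true⇐ (_<ᵇ m) w (λ x∈ → dec-true (_ <? m) (All.lookup (labels< lm) x∈))
        | ball-true⇐ (λ j → countℕ j w ≡ᵇ r) (upTo m) (λ j∈ → dec-true (_ ≟ r) (count≡ lm _ (∈-upTo⁻ j∈))) = refl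

∈-matchings⁺ : ∀ r n w → isMatching r n w ≡ true → w ∈ matchings r n
∈-matchings⁺ r n w match = ∈-bfilter⁺ (isMatching r n)
  (subst (λ L → w ∈ words n L) (length≡ lm) (∈-words n w (labels< lm))) match
  where lm = proj₂ (isMatching-true⇒ r n w match)

∈-matchings⁻ : ∀ r n w → w ∈ matchings r n → isMatching r n w ≡ true
∈-matchings⁻ r n w w∈ = proj₂ (∈-bfilter⁻ (isMatching r n) (words n (r * n)) w∈)

Unique-matchings : ∀ r n → Unique (matchings r n)
Unique-matchings r n = Unique-bfilter (isMatching r n) (Unique-words n (r * n))

_∈ᵇ_ : ℕ → List ℕ → Bool
x ∈ᵇ ys = does (x ∈? ys)

indexOf : ℕ → List ℕ → ℕ
indexOf x [] = 0
indexOf x (y ∷ ys) = if x ≡ᵇ y then 0 else suc (indexOf x ys)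

nth : List ℕ → ℕ → ℕ
nth [] _ = 0
nth (y ∷ ys) zero = y
nth (y ∷ ys) (suc j) = nth ys j

indexOf-< : ∀ {x} ys → x ∈ ys → indexOf x ys < length ys
indexOf-< {x} (y ∷ ys) x∈ with x ≡ᵇ y in x≡y | x∈
... | true | _ = s≤s z≤n
... | false | here refl = ⊥-elim (does-false (x ≟ x) x≡y refl)
... | false | there x∈ys = s≤s (indexOf-< ys x∈ys)

nth-indexOf : ∀ {x} ys → x ∈ ys → nth ys (indexOf x ys) ≡ x
nth-indexOf {x} (y ∷ ys) x∈ with x ≡ᵇ y in x≡y | x∈
... | true | _ = sym (does-true (x ≟ y) x≡y)
... | false | here refl = ⊥-elim (does-false (x ≟ x) x≡y refl)
... | false | there x∈ys = nth-indexOf ys x∈ys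

indexOf-injective : ∀ {x x′} ys → x ∈ ys → x′ ∈ ys → indexOf x ys ≡ indexOf x′ ys → x ≡ x′
indexOf-injective {x} {x′} ys x∈ x′∈ eq = begin
  x                        ≡⟨ nth-indexOf ys x∈ ⟨
  nth ys (indexOf x ys)    ≡⟨ cong (nth ys) eq ⟩
  nth ys (indexOf x′ ys)   ≡⟨ nth-indexOf ys x′∈ ⟩
  x′                       ∎
  where open ≡-Reasoning

nth-∈ : ∀ ys {j} → j < length ys → nth ys j ∈ ys
nth-∈ (y ∷ ys) {zero} _ = here refl
nth-∈ (y ∷ ys) {suc j} (s≤s j<) = there (nth-∈ ys j<)

indexOf-nth : ∀ ys {j} → Unique ys → j < length ys → indexOf (nth ys j) ys ≡ j
indexOf-nth (y ∷ ys) {zero} _ _ rewrite dec-true (y ≟ y) refl = refl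
indexOf-nth (y ∷ ys) {suc j} u@(_ ∷ uys) (s≤s j<)
  rewrite dec-false (nth ys j ≟ y) (λ { refl → Unique-∉ u (nth-∈ ys j<) }) = cong suc (indexOf-nth ys uys j<)

indexOf-++ˡ : ∀ {x} xs ys → x ∈ xs → indexOf x (xs ++ ys) ≡ indexOf x xs
indexOf-++ˡ {x} (y ∷ xs) ys x∈ with x ≡ᵇ y in x≡y | x∈
... | true | _ = refl
... | false | here refl = ⊥-elim (does-false (x ≟ x) x≡y refl)
... | false | there x∈xs = cong suc (indexOf-++ˡ xs ys x∈xs)

indexOf-++ʳ : ∀ {x} xs ys → x ∉ xs → indexOf x (xs ++ ys) ≡ length xs + indexOf x ys
indexOf-++ʳ [] ys _ = refl
indexOf-++ʳ {x} (y ∷ xs) ys x∉ rewrite dec-false (x ≟ y) (x∉ ∘ here) = cong suc (indexOf-++ʳ xs ys (x∉ ∘ there))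

indexOf-upTo : ∀ {K x} → x < K → indexOf x (upTo K) ≡ x
indexOf-upTo {K} {x} x<K = begin
  indexOf x (upTo K)                 ≡⟨ cong (λ y → indexOf y (upTo K)) (nth-upTo K x<K) ⟨
  indexOf (nth (upTo K) x) (upTo K)  ≡⟨ indexOf-nth (upTo K) (upTo⁺ K) (subst (x <_) (sym (length-upTo K)) x<K) ⟩
  x                                  ∎
  where
  open ≡-Reasoning
  nth-applyUpTo : ∀ (f : ℕ → ℕ) K {j} → j < K → nth (applyUpTo f K) j ≡ f j
  nth-applyUpTo f (suc K) {zero} _ = refl
  nth-applyUpTo f (suc K) {suc j} (s≤s j<) = nth-applyUpTo (f ∘ suc) K j<
  nth-upTo : ∀ K {j} → j < K → nth (upTo K) j ≡ j
  nth-upTo = nth-applyUpTo id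

firstOccurrencesAfter : List ℕ → List ℕ → List ℕ
firstOccurrencesAfter seen [] = seen
firstOccurrencesAfter seen (x ∷ xs) with x ∈? seen
... | yes _ = firstOccurrencesAfter seen xs
... | no _ = firstOccurrencesAfter (seen ++ [ x ]) xs

firstOccurrences : List ℕ → List ℕ
firstOccurrences = firstOccurrencesAfter []

Unique-snoc : ∀ {x : A} {seen} → Unique seen → x ∉ seen → Unique (seen ++ [ x ])
Unique-snoc u x∉ = Unique-++⁺ u ([] ∷ []) (λ { (x∈ , here refl) → x∉ x∈ })

firstOccurrencesAfter-∈⁻ : ∀ seen xs {x} → x ∈ firstOccurrencesAfter seen xs → x ∈ seen ⊎ x ∈ xs
firstOccurrencesAfter-∈⁻ seen [] x∈ = inj₁ x∈
firstOccurrencesAfter-∈⁻ seen (y ∷ xs) x∈ with y ∈? seen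
... | yes _ = [ inj₁ , inj₂ ∘ there ]′ (firstOccurrencesAfter-∈⁻ seen xs x∈)
... | no _ with firstOccurrencesAfter-∈⁻ (seen ++ [ y ]) xs x∈
...   | inj₂ x∈xs = inj₂ (there x∈xs)
...   | inj₁ x∈seen′ = [ inj₁ , (λ { (here refl) → inj₂ (here refl) }) ]′ (∈-++⁻ seen x∈seen′)

firstOccurrencesAfter-∈⁺ˡ : ∀ seen xs {x} → x ∈ seen → x ∈ firstOccurrencesAfter seen xs
firstOccurrencesAfter-∈⁺ˡ seen [] x∈ = x∈
firstOccurrencesAfter-∈⁺ˡ seen (y ∷ xs) x∈ with y ∈? seen
... | yes _ = firstOccurrencesAfter-∈⁺ˡ seen xs x∈
... | no _ = firstOccurrencesAfter-∈⁺ˡ (seen ++ [ y ]) xs (∈-++⁺ˡ x∈)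

firstOccurrencesAfter-∈⁺ʳ : ∀ seen xs {x} → x ∈ xs → x ∈ firstOccurrencesAfter seen xs
firstOccurrencesAfter-∈⁺ʳ seen (y ∷ xs) x∈ with y ∈? seen | x∈
... | yes y∈ | here refl = firstOccurrencesAfter-∈⁺ˡ seen xs y∈
... | yes _ | there x∈xs = firstOccurrencesAfter-∈⁺ʳ seen xs x∈xs
... | no _ | here refl = firstOccurrencesAfter-∈⁺ˡ (seen ++ [ y ]) xs (∈-++⁺ʳ seen (here refl))
... | no _ | there x∈xs = firstOccurrencesAfter-∈⁺ʳ (seen ++ [ y ]) xs x∈xs

Unique-firstOccurrencesAfter : ∀ seen xs → Unique seen → Unique (firstOccurrencesAfter seen xs)
Unique-firstOccurrencesAfter seen [] u = u
Unique-firstOccurrencesAfter seen (y ∷ xs) u with y ∈? seen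
... | yes _ = Unique-firstOccurrencesAfter seen xs u
... | no y∉ = Unique-firstOccurrencesAfter (seen ++ [ y ]) xs (Unique-snoc u y∉)

firstOccurrencesAfter-extends : ∀ seen xs → ∃ λ new → firstOccurrencesAfter seen xs ≡ seen ++ new
firstOccurrencesAfter-extends seen [] = [] , sym (++-identityʳ seen)
firstOccurrencesAfter-extends seen (y ∷ xs) with y ∈? seen
... | yes _ = firstOccurrencesAfter-extends seen xs
... | no _ with new , eq ← firstOccurrencesAfter-extends (seen ++ [ y ]) xs =
  y ∷ new , trans eq (++-assoc seen [ y ] new)

∈-firstOccurrences⁻ : ∀ v {x} → x ∈ firstOccurrences v → x ∈ v
∈-firstOccurrences⁻ v x∈ with inj₂ x∈v ← firstOccurrencesAfter-∈⁻ [] v x∈ = x∈v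

∈-firstOccurrences⁺ : ∀ v {x} → x ∈ v → x ∈ firstOccurrences v
∈-firstOccurrences⁺ = firstOccurrencesAfter-∈⁺ʳ []

Unique-firstOccurrences : ∀ v → Unique (firstOccurrences v)
Unique-firstOccurrences v = Unique-firstOccurrencesAfter [] v []

#labels : List ℕ → ℕ
#labels v = length (firstOccurrences v)

rank : List ℕ → ℕ → ℕ
rank v x = indexOf x (firstOccurrences v)

unrank : List ℕ → ℕ → ℕ
unrank v j = nth (firstOccurrences v) j

-- The canonical encoding of Defs: edges relabelled in the order of their first vertices.
normalize : List ℕ → List ℕ
normalize v = map (rank v) v

rank-< : ∀ v {x} → x ∈ v → rank v x < #labels v
rank-< v x∈ = indexOf-< (firstOccurrences v) (∈-firstOccurrences⁺ v x∈)

rank-injective : ∀ v → InjectiveOn (rank v) v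
rank-injective v x∈ x′∈ = indexOf-injective (firstOccurrences v) (∈-firstOccurrences⁺ v x∈) (∈-firstOccurrences⁺ v x′∈)

unrank-rank : ∀ v {x} → x ∈ v → unrank v (rank v x) ≡ x
unrank-rank v x∈ = nth-indexOf (firstOccurrences v) (∈-firstOccurrences⁺ v x∈)

unrank-∈ : ∀ v {j} → j < #labels v → unrank v j ∈ v
unrank-∈ v j< = ∈-firstOccurrences⁻ v (nth-∈ (firstOccurrences v) j<)

rank-unrank : ∀ v {j} → j < #labels v → rank v (unrank v j) ≡ j
rank-unrank v j< = indexOf-nth (firstOccurrences v) (Unique-firstOccurrences v) j<

unrank-injective : ∀ v {i j} → i < #labels v → j < #labels v → unrank v i ≡ unrank v j → i ≡ j
unrank-injective v {i} {j} i< j< eq = begin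
  i                    ≡⟨ rank-unrank v i< ⟨
  rank v (unrank v i)  ≡⟨ cong (rank v) eq ⟩
  rank v (unrank v j)  ≡⟨ rank-unrank v j< ⟩
  j                    ∎
  where open ≡-Reasoning

unrank-normalize : ∀ v → map (unrank v) (normalize v) ≡ v
unrank-normalize v = trans (sym (map-∘ v)) (trans (map-cong-∈ _ id v (unrank-rank v)) (map-id v))

normalize-< : ∀ v → All (_< #labels v) (normalize v)
normalize-< v = All.tabulate λ y∈ → case-∈ (∈-map⁻ (rank v) y∈)
  where
  case-∈ : ∀ {y} → (∃ λ x → x ∈ v × y ≡ rank v x) → y < #labels v
  case-∈ (x , x∈ , refl) = rank-< v x∈

rg-< : ∀ {k i} xs → i < k → rg k xs ≡ true → rg k (i ∷ xs) ≡ true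
rg-< {k} {i} xs i<k rg-xs rewrite dec-true (i <? k) i<k = rg-xs

rg-new : ∀ k xs → rg (suc k) xs ≡ true → rg k (k ∷ xs) ≡ true
rg-new k xs rg-xs rewrite dec-false (k <? k) (n≮n k) | dec-true (k ≟ k) refl = rg-xs

rg-normalizeAfter : ∀ seen xs → Unique seen →
  rg (length seen) (map (λ x → indexOf x (firstOccurrencesAfter seen xs)) xs) ≡ true
rg-normalizeAfter seen [] _ = refl
rg-normalizeAfter seen (x ∷ xs) u with x ∈? seen
... | yes x∈ with new , eq ← firstOccurrencesAfter-extends seen xs =
  rg-< (map (λ y → indexOf y (firstOccurrencesAfter seen xs)) xs) old-rank (rg-normalizeAfter seen xs u)
  where
  old-rank : indexOf x (firstOccurrencesAfter seen xs) < length seen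
  old-rank rewrite eq | indexOf-++ˡ seen new x∈ = indexOf-< seen x∈
... | no x∉ with new , eq ← firstOccurrencesAfter-extends (seen ++ [ x ]) xs =
  subst (λ i → rg (length seen) (i ∷ ranks) ≡ true) (sym new-rank)
    (rg-new (length seen) ranks (subst (λ k → rg k ranks ≡ true) length-snoc
      (rg-normalizeAfter (seen ++ [ x ]) xs (Unique-snoc u x∉))))
  where
  ranks : List ℕ
  ranks = map (λ y → indexOf y (firstOccurrencesAfter (seen ++ [ x ]) xs)) xs
  length-snoc : length (seen ++ [ x ]) ≡ suc (length seen)
  length-snoc = trans (length-++ seen) (+-comm (length seen) 1)
  new-rank : indexOf x (firstOccurrencesAfter (seen ++ [ x ]) xs) ≡ length seen
  new-rank rewrite eq | ++-assoc seen [ x ] new | indexOf-++ʳ seen (x ∷ new) x∉ | dec-true (x ≟ x) refl =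
    +-identityʳ (length seen)

rg-normalize : ∀ v → rg 0 (normalize v) ≡ true
rg-normalize v = rg-normalizeAfter [] v []

rg⇒firstOccurrencesAfter-upTo : ∀ k xs → rg k xs ≡ true →
  ∃ λ K → k ≤ K × firstOccurrencesAfter (upTo k) xs ≡ upTo K × All (_< K) xs
rg⇒firstOccurrencesAfter-upTo k [] _ = k , ≤-refl , refl , []
rg⇒firstOccurrencesAfter-upTo k (x ∷ xs) rg-xs with x <ᵇ k in x<k | x ≡ᵇ k in x≡k | x ∈? upTo k
... | true | _ | yes _ with K , k≤K , eq , xs<K ← rg⇒firstOccurrencesAfter-upTo k xs rg-xs =
  K , k≤K , eq , <-≤-trans (does-true (x <? k) x<k) k≤K ∷ xs<K
... | true | _ | no x∉ = ⊥-elim (x∉ (∈-upTo⁺ (does-true (x <? k) x<k)))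
... | false | true | yes x∈ = ⊥-elim (does-false (x <? k) x<k (∈-upTo⁻ x∈))
... | false | true | no _ rewrite does-true (x ≟ k) x≡k | upTo-∷ʳ k
  with K , k<K , eq , xs<K ← rg⇒firstOccurrencesAfter-upTo (suc k) xs rg-xs =
  K , <⇒≤ k<K , eq , k<K ∷ xs<K

normalize-rg : ∀ w → rg 0 w ≡ true → normalize w ≡ w
normalize-rg w rg-w with K , _ , eq , w<K ← rg⇒firstOccurrencesAfter-upTo 0 w rg-w =
  trans (map-cong-∈ (rank w) id w (λ {x} x∈ → trans (cong (indexOf x) eq) (indexOf-upTo (All.lookup w<K x∈))))
        (map-id w)

firstOccurrencesAfter-map : ∀ (f : ℕ → ℕ) {U} → InjectiveOn f U → ∀ seen xs → seen ⊆ U → xs ⊆ U →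
  firstOccurrencesAfter (map f seen) (map f xs) ≡ map f (firstOccurrencesAfter seen xs)
firstOccurrencesAfter-map f inj seen [] _ _ = refl
firstOccurrencesAfter-map f inj seen (x ∷ xs) seen⊆ xs⊆ with x ∈? seen | f x ∈? map f seen
... | yes _ | yes _ = firstOccurrencesAfter-map f inj seen xs seen⊆ (xs⊆ ∘ there)
... | yes x∈ | no fx∉ = ⊥-elim (fx∉ (∈-map⁺ f x∈))
... | no x∉ | yes fx∈ with y , y∈ , fx≡fy ← ∈-map⁻ f fx∈ =
  ⊥-elim (x∉ (subst (_∈ seen) (sym (inj (xs⊆ (here refl)) (seen⊆ y∈) fx≡fy)) y∈))
... | no _ | no _ rewrite sym (map-++ f seen [ x ]) =
  firstOccurrencesAfter-map f inj (seen ++ [ x ]) xs snoc⊆ (xs⊆ ∘ there)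
  where
  snoc⊆ : seen ++ [ x ] ⊆ _
  snoc⊆ y∈ = [ seen⊆ , (λ { (here refl) → xs⊆ (here refl) }) ]′ (∈-++⁻ seen y∈)

indexOf-map : ∀ (f : ℕ → ℕ) {U} → InjectiveOn f U → ∀ {x} ys → x ∈ U → ys ⊆ U →
  indexOf (f x) (map f ys) ≡ indexOf x ys
indexOf-map f inj [] _ _ = refl
indexOf-map f inj {x} (y ∷ ys) x∈ ys⊆ with x ≡ᵇ y in x≡y
... | true rewrite does-true (x ≟ y) x≡y | dec-true (f y ≟ f y) refl = refl
... | false rewrite dec-false (f x ≟ f y) (does-false (x ≟ y) x≡y ∘ inj x∈ (ys⊆ (here refl))) =
  cong suc (indexOf-map f inj ys x∈ (ys⊆ ∘ there))

normalize-map : ∀ (f : ℕ → ℕ) v → InjectiveOn f v → normalize (map f v) ≡ normalize v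
normalize-map f v inj = trans (sym (map-∘ v)) (map-cong-∈ _ _ v rank-map)
  where
  rank-map : ∀ {x} → x ∈ v → rank (map f v) (f x) ≡ rank v x
  rank-map {x} x∈ = trans (cong (indexOf (f x)) (firstOccurrencesAfter-map f inj [] v (λ ()) id))
                          (indexOf-map f inj (firstOccurrences v) x∈ (∈-firstOccurrences⁻ v))

Regular : ℕ → List ℕ → Set
Regular r v = ∀ {x} → x ∈ v → countℕ x v ≡ r

countℕ-normalize : ∀ v {x} → x ∈ v → countℕ (rank v x) (normalize v) ≡ countℕ x v
countℕ-normalize v x∈ = countℕ-map (rank v) _ v (λ y∈ → rank-injective v y∈ x∈)

normalize-regular : ∀ {r} v → Regular r v → ∀ j → j < #labels v → countℕ j (normalize v) ≡ r
normalize-regular v reg j j< = begin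
  countℕ j (normalize v)                     ≡⟨ cong (λ i → countℕ i (normalize v)) (rank-unrank v j<) ⟨
  countℕ (rank v (unrank v j)) (normalize v) ≡⟨ countℕ-normalize v (unrank-∈ v j<) ⟩
  countℕ (unrank v j) v                      ≡⟨ reg (unrank-∈ v j<) ⟩
  _                                          ∎
  where open ≡-Reasoning

≡ᵇ-sym : ∀ x y → (x ≡ᵇ y) ≡ (y ≡ᵇ x)
≡ᵇ-sym zero zero = refl
≡ᵇ-sym zero (suc y) = refl
≡ᵇ-sym (suc x) zero = refl
≡ᵇ-sym (suc x) (suc y) = ≡ᵇ-sym x y

length-bfilter-∈ᵇ : ∀ {r} D v → Unique D → (∀ {d} → d ∈ D → countℕ d v ≡ r) →
  length (bfilter (_∈ᵇ D) v) ≡ length D * r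
length-bfilter-∈ᵇ [] v _ _ = cong length (bfilter-none v)
  where
  bfilter-none : ∀ v → bfilter (_∈ᵇ []) v ≡ []
  bfilter-none [] = refl
  bfilter-none (_ ∷ v) = bfilter-none v
length-bfilter-∈ᵇ {r} (d ∷ D) v u@(_ ∷ uD) counts = begin
  length (bfilter (_∈ᵇ (d ∷ D)) v)                            ≡⟨ length-bfilter-∨ (_≡ᵇ d) (_∈ᵇ D) v not-both ⟩
  length (bfilter (_≡ᵇ d) v) + length (bfilter (_∈ᵇ D) v)
    ≡⟨ cong₂ _+_ count-d (length-bfilter-∈ᵇ D v uD (counts ∘ there)) ⟩
  r + length D * r                                            ∎
  where
  open ≡-Reasoning
  not-both : ∀ {x} → x ∈ v → (x ≡ᵇ d) ≡ true → (x ∈ᵇ D) ≡ false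
  not-both {x} _ x≡d rewrite does-true (x ≟ d) x≡d = dec-false (d ∈? D) (Unique-∉ u)
  count-d : length (bfilter (_≡ᵇ d) v) ≡ r
  count-d = trans (cong length (bfilter-cong (_≡ᵇ d) (d ≡ᵇ_) v (λ {x} _ → ≡ᵇ-sym x d))) (counts (here refl))

length-regular : ∀ {r} v → Regular r v → length v ≡ #labels v * r
length-regular v reg = begin
  length v                                         ≡⟨ cong length (bfilter-all (_∈ᵇ firstOccurrences v) v all-in) ⟨
  length (bfilter (_∈ᵇ firstOccurrences v) v)
    ≡⟨ length-bfilter-∈ᵇ (firstOccurrences v) v (Unique-firstOccurrences v) (reg ∘ ∈-firstOccurrences⁻ v) ⟩
  #labels v * _                                    ∎
  where
  open ≡-Reasoning
  all-in : ∀ {x} → x ∈ v → (x ∈ᵇ firstOccurrences v) ≡ true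
  all-in x∈ = dec-true (_ ∈? firstOccurrences v) (∈-firstOccurrences⁺ v x∈)

#labels-regular : ∀ {r n} v → .{{NonZero r}} → length v ≡ r * n → Regular r v → #labels v ≡ n
#labels-regular {r} {n} v len reg = *-cancelʳ-≡ (#labels v) n r (begin
  #labels v * r   ≡⟨ length-regular v reg ⟨
  length v        ≡⟨ len ⟩
  r * n           ≡⟨ *-comm r n ⟩
  n * r           ∎)
  where open ≡-Reasoning

normalize-isMatching : ∀ {r n} v → .{{NonZero r}} → length v ≡ r * n → Regular r v →
  isMatching r n (normalize v) ≡ true
normalize-isMatching {r} {n} v len reg = isMatching-true⇐ r n (normalize v) (rg-normalize v) record
  { length≡ = trans (length-map (rank v) v) len
  ; labels< = subst (λ K → All (_< K) (normalize v)) #labels≡n (normalize-< v)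
  ; count≡ = λ j j<n → normalize-regular v reg j (subst (j <_) (sym #labels≡n) j<n)
  }
  where #labels≡n = #labels-regular v len reg

interleave : List Bool → List ℕ → List ℕ → List ℕ
interleave [] u c = []
interleave (true ∷ b) [] c = []
interleave (true ∷ b) (x ∷ u) c = x ∷ interleave b u c
interleave (false ∷ b) u [] = []
interleave (false ∷ b) u (x ∷ c) = x ∷ interleave b u c

#true : List Bool → ℕ
#true [] = 0
#true (true ∷ b) = suc (#true b)
#true (false ∷ b) = #true b

#false : List Bool → ℕ
#false [] = 0
#false (true ∷ b) = #false b
#false (false ∷ b) = suc (#false b)

keepTrue : List Bool → List ℕ → List ℕ
keepTrue [] v = []
keepTrue (_ ∷ b) [] = []
keepTrue (true ∷ b) (x ∷ v) = x ∷ keepTrue b v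
keepTrue (false ∷ b) (x ∷ v) = keepTrue b v

keepFalse : List Bool → List ℕ → List ℕ
keepFalse [] v = []
keepFalse (_ ∷ b) [] = []
keepFalse (true ∷ b) (x ∷ v) = keepFalse b v
keepFalse (false ∷ b) (x ∷ v) = x ∷ keepFalse b v

map-interleave : ∀ (f : ℕ → ℕ) b u c → map f (interleave b u c) ≡ interleave b (map f u) (map f c)
map-interleave f [] u c = refl
map-interleave f (true ∷ b) [] c = refl
map-interleave f (true ∷ b) (x ∷ u) c = cong (f x ∷_) (map-interleave f b u c)
map-interleave f (false ∷ b) u [] = refl
map-interleave f (false ∷ b) u (x ∷ c) = cong (f x ∷_) (map-interleave f b u c)

keepTrue-interleave : ∀ b u c → length u ≡ #true b → length c ≡ #false b → keepTrue b (interleave b u c) ≡ u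
keepTrue-interleave [] [] c _ _ = refl
keepTrue-interleave (true ∷ b) (x ∷ u) c lu lc = cong (x ∷_) (keepTrue-interleave b u c (suc-injective lu) lc)
keepTrue-interleave (false ∷ b) u (x ∷ c) lu lc = keepTrue-interleave b u c lu (suc-injective lc)

keepFalse-interleave : ∀ b u c → length u ≡ #true b → length c ≡ #false b → keepFalse b (interleave b u c) ≡ c
keepFalse-interleave [] u [] _ _ = refl
keepFalse-interleave (true ∷ b) (x ∷ u) c lu lc = keepFalse-interleave b u c (suc-injective lu) lc
keepFalse-interleave (false ∷ b) u (x ∷ c) lu lc = cong (x ∷_) (keepFalse-interleave b u c lu (suc-injective lc))

interleave-bfilter : (p : ℕ → Bool) (w : List ℕ) → interleave (map p w) (bfilter p w) (bfilter (not ∘ p) w) ≡ w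
interleave-bfilter p [] = refl
interleave-bfilter p (x ∷ w) with p x
... | true = cong (x ∷_) (interleave-bfilter p w)
... | false = cong (x ∷_) (interleave-bfilter p w)

length-bfilter-#true : (p : ℕ → Bool) (w : List ℕ) → length (bfilter p w) ≡ #true (map p w)
length-bfilter-#true p [] = refl
length-bfilter-#true p (x ∷ w) with p x
... | true = cong suc (length-bfilter-#true p w)
... | false = length-bfilter-#true p w

length-bfilter-#false : (p : ℕ → Bool) (w : List ℕ) → length (bfilter (not ∘ p) w) ≡ #false (map p w)
length-bfilter-#false p [] = refl
length-bfilter-#false p (x ∷ w) with p x
... | true = length-bfilter-#false p w
... | false = cong suc (length-bfilter-#false p w)

∈-interleave⁻ : ∀ b u c {x} → x ∈ interleave b u c → x ∈ u ⊎ x ∈ c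
∈-interleave⁻ (true ∷ b) (y ∷ u) c (here e) = inj₁ (here e)
∈-interleave⁻ (true ∷ b) (y ∷ u) c (there x∈) = [ inj₁ ∘ there , inj₂ ]′ (∈-interleave⁻ b u c x∈)
∈-interleave⁻ (false ∷ b) u (y ∷ c) (here e) = inj₂ (here e)
∈-interleave⁻ (false ∷ b) u (y ∷ c) (there x∈) = [ inj₁ , inj₂ ∘ there ]′ (∈-interleave⁻ b u c x∈)

countℕ-interleave : ∀ x b u c → length u ≡ #true b → length c ≡ #false b →
  countℕ x (interleave b u c) ≡ countℕ x u + countℕ x c
countℕ-interleave x [] [] [] _ _ = refl
countℕ-interleave x (true ∷ b) (y ∷ u) c lu lc with x ≡ᵇ y
... | true = cong suc (countℕ-interleave x b u c (suc-injective lu) lc)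
... | false = countℕ-interleave x b u c (suc-injective lu) lc
countℕ-interleave x (false ∷ b) u (y ∷ c) lu lc with x ≡ᵇ y
... | true = trans (cong suc (countℕ-interleave x b u c lu (suc-injective lc))) (sym (+-suc _ _))
... | false = countℕ-interleave x b u c lu (suc-injective lc)

length-interleave : ∀ b u c → length u ≡ #true b → length c ≡ #false b → length (interleave b u c) ≡ length b
length-interleave [] u c _ _ = refl
length-interleave (true ∷ b) (x ∷ u) c lu lc = cong suc (length-interleave b u c (suc-injective lu) lc)
length-interleave (false ∷ b) u (x ∷ c) lu lc = cong suc (length-interleave b u c lu (suc-injective lc))

map-interleave-mask : (q : ℕ → Bool) → ∀ b u c → length u ≡ #true b → length c ≡ #false b →
  (∀ {x} → x ∈ u → q x ≡ true) → (∀ {x} → x ∈ c → q x ≡ false) → map q (interleave b u c) ≡ b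
map-interleave-mask q [] u c _ _ _ _ = refl
map-interleave-mask q (true ∷ b) (x ∷ u) c lu lc qu qc =
  cong₂ _∷_ (qu (here refl)) (map-interleave-mask q b u c (suc-injective lu) lc (qu ∘ there) qc)
map-interleave-mask q (false ∷ b) u (x ∷ c) lu lc qu qc =
  cong₂ _∷_ (qc (here refl)) (map-interleave-mask q b u c lu (suc-injective lc) qu (qc ∘ there))

normalize-interleave-cong : ∀ b u₁ c₁ u₂ c₂ →
  length u₁ ≡ #true b → length c₁ ≡ #false b → length u₂ ≡ #true b → length c₂ ≡ #false b →
  (∀ {x} → x ∈ u₁ → x ∉ c₁) → (∀ {x} → x ∈ u₂ → x ∉ c₂) →
  normalize u₁ ≡ normalize u₂ → normalize c₁ ≡ normalize c₂ →
  normalize (interleave b u₁ c₁) ≡ normalize (interleave b u₂ c₂)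
normalize-interleave-cong b u₁ c₁ u₂ c₂ lu₁ lc₁ lu₂ lc₂ disj₁ disj₂ eqᵘ eqᶜ = begin
  normalize (interleave b u₁ c₁)                   ≡⟨ normalize-map h (interleave b u₁ c₁) h-injective ⟨
  normalize (map h (interleave b u₁ c₁))           ≡⟨ cong normalize (map-interleave h b u₁ c₁) ⟩
  normalize (interleave b (map h u₁) (map h c₁))
    ≡⟨ cong normalize (cong₂ (interleave b) (h-on u₁ hᵘ eqᵘ) (h-on c₁ hᶜ eqᶜ)) ⟩
  normalize (interleave b u₂ c₂)                   ∎
  where
  open ≡-Reasoning
  h : ℕ → ℕ
  h x = if x ∈ᵇ u₁ then unrank u₂ (rank u₁ x) else unrank c₂ (rank c₁ x)
  hᵘ : ∀ {x} → x ∈ u₁ → h x ≡ unrank u₂ (rank u₁ x)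
  hᵘ x∈ rewrite dec-true (_ ∈? u₁) x∈ = refl
  hᶜ : ∀ {x} → x ∈ c₁ → h x ≡ unrank c₂ (rank c₁ x)
  hᶜ x∈ rewrite dec-false (_ ∈? u₁) (λ x∈u₁ → disj₁ x∈u₁ x∈) = refl
  h-on : ∀ v₁ {v₂} → (∀ {x} → x ∈ v₁ → h x ≡ unrank v₂ (rank v₁ x)) →
    normalize v₁ ≡ normalize v₂ → map h v₁ ≡ v₂
  h-on v₁ {v₂} hv eq = begin
    map h v₁                           ≡⟨ map-cong-∈ _ _ v₁ hv ⟩
    map (unrank v₂ ∘ rank v₁) v₁       ≡⟨ map-∘ v₁ ⟩
    map (unrank v₂) (normalize v₁)     ≡⟨ cong (map (unrank v₂)) eq ⟩
    map (unrank v₂) (normalize v₂)     ≡⟨ unrank-normalize v₂ ⟩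
    v₂                                 ∎
  rank-bound : ∀ v₁ v₂ → normalize v₁ ≡ normalize v₂ → ∀ {x} → x ∈ v₁ → rank v₁ x < #labels v₂
  rank-bound v₁ v₂ eq x∈ = All.lookup (normalize-< v₂) (subst (_ ∈_) eq (∈-map⁺ (rank v₁) x∈))
  h-injective : InjectiveOn h (interleave b u₁ c₁)
  h-injective x∈ y∈ hx≡hy with ∈-interleave⁻ b u₁ c₁ x∈ | ∈-interleave⁻ b u₁ c₁ y∈
  ... | inj₁ x∈u | inj₁ y∈u = rank-injective u₁ x∈u y∈u
    (unrank-injective u₂ (rank-bound u₁ u₂ eqᵘ x∈u) (rank-bound u₁ u₂ eqᵘ y∈u)
      (trans (sym (hᵘ x∈u)) (trans hx≡hy (hᵘ y∈u))))
  ... | inj₂ x∈c | inj₂ y∈c = rank-injective c₁ x∈c y∈c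
    (unrank-injective c₂ (rank-bound c₁ c₂ eqᶜ x∈c) (rank-bound c₁ c₂ eqᶜ y∈c)
      (trans (sym (hᶜ x∈c)) (trans hx≡hy (hᶜ y∈c))))
  ... | inj₁ x∈u | inj₂ y∈c = ⊥-elim (disj₂ (unrank-∈ u₂ (rank-bound u₁ u₂ eqᵘ x∈u))
    (subst (_∈ c₂) (trans (sym (hᶜ y∈c)) (trans (sym hx≡hy) (hᵘ x∈u))) (unrank-∈ c₂ (rank-bound c₁ c₂ eqᶜ y∈c))))
  ... | inj₂ x∈c | inj₁ y∈u = ⊥-elim (disj₂ (unrank-∈ u₂ (rank-bound u₁ u₂ eqᵘ y∈u))
    (subst (_∈ c₂) (trans (sym (hᶜ x∈c)) (trans hx≡hy (hᵘ y∈u))) (unrank-∈ c₂ (rank-bound c₁ c₂ eqᶜ x∈c))))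

patternWord : List ℕ → List Bool
patternWord [] = []
patternWord (h ∷ v) = map (_≡ᵇ h) (h ∷ v)

pattern2≡patternWord : ∀ w a b → pattern2 w a b ≡ patternWord (bfilter (λ x → (x ≡ᵇ a) ∨ (x ≡ᵇ b)) w)
pattern2≡patternWord w a b with bfilter (λ x → (x ≡ᵇ a) ∨ (x ≡ᵇ b)) w
... | [] = refl
... | _ ∷ _ = refl

pattern2-sym : ∀ w a b → pattern2 w a b ≡ pattern2 w b a
pattern2-sym w a b = begin
  pattern2 w a b                                                    ≡⟨ pattern2≡patternWord w a b ⟩
  patternWord (bfilter (λ x → (x ≡ᵇ a) ∨ (x ≡ᵇ b)) w)
    ≡⟨ cong patternWord (bfilter-cong _ _ w (λ {x} _ → ∨-comm (x ≡ᵇ a) (x ≡ᵇ b))) ⟩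
  patternWord (bfilter (λ x → (x ≡ᵇ b) ∨ (x ≡ᵇ a)) w)               ≡⟨ pattern2≡patternWord w b a ⟨
  pattern2 w b a                                                    ∎
  where open ≡-Reasoning

≡ᵇ-injectiveOn : ∀ (f : ℕ → ℕ) {U} → InjectiveOn f U → ∀ {x y} → x ∈ U → y ∈ U →
  (f x ≡ᵇ f y) ≡ (x ≡ᵇ y)
≡ᵇ-injectiveOn f inj {x} {y} x∈ y∈ with x ≡ᵇ y in x≡y
... | true rewrite does-true (x ≟ y) x≡y = dec-true (f y ≟ f y) refl
... | false = dec-false (f x ≟ f y) (does-false (x ≟ y) x≡y ∘ inj x∈ y∈)

patternWord-map : ∀ (f : ℕ → ℕ) {U} → InjectiveOn f U → ∀ v → v ⊆ U → patternWord (map f v) ≡ patternWord v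
patternWord-map f inj [] _ = refl
patternWord-map f inj (h ∷ v) v⊆ =
  trans (sym (map-∘ (h ∷ v))) (map-cong-∈ _ _ (h ∷ v) (λ x∈ → ≡ᵇ-injectiveOn f inj (v⊆ x∈) (v⊆ (here refl))))

pattern2-map : ∀ (f : ℕ → ℕ) v → InjectiveOn f v → ∀ {a b} → a ∈ v → b ∈ v →
  pattern2 (map f v) (f a) (f b) ≡ pattern2 v a b
pattern2-map f v inj {a} {b} a∈ b∈ = begin
  pattern2 (map f v) (f a) (f b)                                         ≡⟨ pattern2≡patternWord (map f v) (f a) (f b) ⟩
  patternWord (bfilter (λ y → (y ≡ᵇ f a) ∨ (y ≡ᵇ f b)) (map f v))         ≡⟨ cong patternWord (bfilter-map _ f v) ⟩
  patternWord (map f (bfilter (λ x → (f x ≡ᵇ f a) ∨ (f x ≡ᵇ f b)) v))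
    ≡⟨ cong (patternWord ∘ map f) (bfilter-cong _ _ v same-test) ⟩
  patternWord (map f (bfilter (λ x → (x ≡ᵇ a) ∨ (x ≡ᵇ b)) v))
    ≡⟨ patternWord-map f inj _ (proj₁ ∘ ∈-bfilter⁻ _ v) ⟩
  patternWord (bfilter (λ x → (x ≡ᵇ a) ∨ (x ≡ᵇ b)) v)                     ≡⟨ pattern2≡patternWord v a b ⟨
  pattern2 v a b                                                         ∎
  where
  open ≡-Reasoning
  same-test : ∀ {x} → x ∈ v → ((f x ≡ᵇ f a) ∨ (f x ≡ᵇ f b)) ≡ ((x ≡ᵇ a) ∨ (x ≡ᵇ b))
  same-test x∈ = cong₂ _∨_ (≡ᵇ-injectiveOn f inj x∈ a∈) (≡ᵇ-injectiveOn f inj x∈ b∈)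

pattern2-bfilter : ∀ (p : ℕ → Bool) w a b → p a ≡ true → p b ≡ true → pattern2 (bfilter p w) a b ≡ pattern2 w a b
pattern2-bfilter p w a b pa pb = begin
  pattern2 (bfilter p w) a b                                        ≡⟨ pattern2≡patternWord (bfilter p w) a b ⟩
  patternWord (bfilter (λ x → (x ≡ᵇ a) ∨ (x ≡ᵇ b)) (bfilter p w))
    ≡⟨ cong patternWord (bfilter-bfilter p _ w a-or-b⇒p) ⟩
  patternWord (bfilter (λ x → (x ≡ᵇ a) ∨ (x ≡ᵇ b)) w)               ≡⟨ pattern2≡patternWord w a b ⟨
  pattern2 w a b                                                    ∎
  where
  open ≡-Reasoning
  a-or-b⇒p : ∀ x → ((x ≡ᵇ a) ∨ (x ≡ᵇ b)) ≡ true → p x ≡ true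
  a-or-b⇒p x x≡a∨b with x ≡ᵇ a in x≡a
  ... | true rewrite does-true (x ≟ a) x≡a = pa
  ... | false rewrite does-true (x ≟ b) x≡a∨b = pb

trace-< : ∀ {r} seen xs → (∀ {x} → x ∈ xs → countℕ x seen + countℕ x xs ≤ r) → All (_< suc r) (traceAux seen xs)
trace-< seen [] _ = []
trace-< {r} seen (x ∷ xs) bound = s≤s head-bound ∷ trace-< (x ∷ seen) xs tail-bound
  where
  head-bound : suc (countℕ x seen) ≤ r
  head-bound with bound (here refl)
  ... | b rewrite dec-true (x ≟ x) refl = ≤-trans (s≤s (m≤m+n _ _)) (subst (_≤ r) (+-suc (countℕ x seen) (countℕ x xs)) b)
  tail-bound : ∀ {z} → z ∈ xs → countℕ z (x ∷ seen) + countℕ z xs ≤ r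
  tail-bound {z} z∈ with bound (there z∈)
  ... | b with z ≡ᵇ x
  ...   | true = subst (_≤ r) (+-suc _ _) b
  ...   | false = b

length-traceAux : ∀ seen xs → length (traceAux seen xs) ≡ length xs
length-traceAux seen [] = refl
length-traceAux seen (x ∷ xs) = cong suc (length-traceAux (x ∷ seen) xs)

trace∈words : ∀ {r} v → Regular r v → trace v ∈ words (suc r) (length v)
trace∈words {r} v reg = subst (λ L → trace v ∈ words (suc r) L) (length-traceAux [] v)
  (∈-words (suc r) (trace v) (trace-< [] v (≤-reflexive ∘ reg)))

[]∈subs : ∀ xs → [] ∈ subs xs
[]∈subs [] = here refl
[]∈subs (x ∷ xs) = ∈-++⁺ˡ ([]∈subs xs)

∈-subs⁻ : ∀ x xs {S} → S ∈ subs (x ∷ xs) → S ∈ subs xs ⊎ ∃ λ S′ → S′ ∈ subs xs × S ≡ x ∷ S′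
∈-subs⁻ x xs S∈ = [ inj₁ , inj₂ ∘ ∈-map⁻ (x ∷_) ]′ (∈-++⁻ (subs xs) S∈)

take∈subs : ∀ xs {S} k → S ∈ subs xs → take k S ∈ subs xs
take∈subs [] zero _ = here refl
take∈subs [] (suc k) (here refl) = here refl
take∈subs (x ∷ xs) k S∈ with ∈-subs⁻ x xs S∈
... | inj₁ S∈xs = ∈-++⁺ˡ (take∈subs xs k S∈xs)
... | inj₂ (S′ , S′∈ , refl) with k
...   | zero = ∈-++⁺ˡ ([]∈subs xs)
...   | suc k′ = ∈-++⁺ʳ (subs xs) (∈-map⁺ (x ∷_) (take∈subs xs k′ S′∈))

All-subs : ∀ {Q : ℕ → Set} xs {S} → All Q xs → S ∈ subs xs → All Q S
All-subs [] _ (here refl) = []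
All-subs (x ∷ xs) (qx ∷ qxs) S∈ with ∈-subs⁻ x xs S∈
... | inj₁ S∈xs = All-subs xs qxs S∈xs
... | inj₂ (S′ , S′∈ , refl) = qx ∷ All-subs xs qxs S′∈

Unique-subs : ∀ xs {S} → Unique xs → S ∈ subs xs → Unique S
Unique-subs [] _ (here refl) = []
Unique-subs (x ∷ xs) (x∉ ∷ u) S∈ with ∈-subs⁻ x xs S∈
... | inj₁ S∈xs = Unique-subs xs u S∈xs
... | inj₂ (S′ , S′∈ , refl) = All-subs xs x∉ S′∈ ∷ Unique-subs xs u S′∈

headOr : A → List A → A
headOr d [] = d
headOr d (x ∷ _) = x

headOr-∈ : ∀ (d : A) xs → 0 < length xs → headOr d xs ∈ xs
headOr-∈ d (y ∷ _) _ = here refl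

map-cancel-< : ∀ μ (h₁ h₂ : ℕ → ℕ) {y₁ y₂} → (∀ j → j < μ → h₁ j ≡ h₂ j) →
  (∀ {j j′} → j < μ → j′ < μ → h₂ j ≡ h₂ j′ → j ≡ j′) →
  All (_< μ) y₁ → All (_< μ) y₂ → map h₁ y₁ ≡ map h₂ y₂ → y₁ ≡ y₂
map-cancel-< μ h₁ h₂ {[]} {[]} _ _ _ _ _ = refl
map-cancel-< μ h₁ h₂ {j ∷ y₁} {j′ ∷ y₂} h₁≡h₂ h₂-inj (j< ∷ y₁<) (j′< ∷ y₂<) eq =
  cong₂ _∷_ (h₂-inj j< j′< (trans (sym (h₁≡h₂ j j<)) (∷-injectiveˡ eq)))
            (map-cancel-< μ h₁ h₂ h₁≡h₂ h₂-inj y₁< y₂< (∷-injectiveʳ eq))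

module CliqueResampling (r : ℕ) .{{_ : NonZero r}} (P : PatternSet) (rec : Reconstructible r P) (n μ : ℕ) where

  cliquesOfSize : List ℕ → List (List ℕ)
  cliquesOfSize w = bfilter (λ S → (length S ≡ᵇ μ) ∧ isCliqueOn P w S) (subs (upTo n))

  chosenClique : List ℕ → List ℕ
  chosenClique w = headOr [] (cliquesOfSize w)

  HasClique : List ℕ → Set
  HasClique w = isMatching r n w ≡ true × chosenClique w ∈ cliquesOfSize w

  inClique : List ℕ → ℕ → Bool
  inClique w x = x ∈ᵇ chosenClique w

  cliqueMask : List ℕ → List Bool
  cliqueMask w = map (inClique w) w

  cliquePart : List ℕ → List ℕ
  cliquePart w = bfilter (inClique w) w

  restPart : List ℕ → List ℕ
  restPart w = bfilter (not ∘ inClique w) w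

  -- The new labels n + j cannot collide with the labels (< n) of the edges outside the clique.
  splice : List ℕ → List ℕ → List ℕ
  splice w y = interleave (cliqueMask w) (map (n +_) y) (restPart w)

  newLabels : List ℕ → List ℕ → List ℕ
  newLabels w y = map (λ j → rank (splice w y) (n + j)) (upTo μ)

  encode : List ℕ × List ℕ → List ℕ × List ℕ × List ℕ
  encode (w , y) = normalize (splice w y) , newLabels w y , trace (normalize (cliquePart w))

  Codes : List (List ℕ × List ℕ × List ℕ)
  Codes = cartesianProduct (matchings r n) (cartesianProduct (words n μ) (words (suc r) (r * μ)))

  module Clique (w : List ℕ) (hw : HasClique w) where

    rg-w : rg 0 w ≡ true
    rg-w = proj₁ (isMatching-true⇒ r n w (proj₁ hw))

    w-labelled : IsLabelledMatching r n w
    w-labelled = proj₂ (isMatching-true⇒ r n w (proj₁ hw))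

    S : List ℕ
    S = chosenClique w
    u : List ℕ
    u = cliquePart w
    c : List ℕ
    c = restPart w
    b : List Bool
    b = cliqueMask w

    S∈subs : S ∈ subs (upTo n)
    S∈subs = proj₁ (∈-bfilter⁻ _ (subs (upTo n)) (proj₂ hw))

    S-size-clique : (length S ≡ᵇ μ) ≡ true × isCliqueOn P w S ≡ true
    S-size-clique = ∧-true {length S ≡ᵇ μ} (proj₂ (∈-bfilter⁻ _ (subs (upTo n)) (proj₂ hw)))

    length-S : length S ≡ μ
    length-S = does-true (length S ≟ μ) (proj₁ S-size-clique)

    Unique-S : Unique S
    Unique-S = Unique-subs (upTo n) (upTo⁺ n) S∈subs

    S<n : All (_< n) S
    S<n = All-subs (upTo n) (All.tabulate ∈-upTo⁻) S∈subs

    ∈-u⁻ : ∀ {x} → x ∈ u → x ∈ w × inClique w x ≡ true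
    ∈-u⁻ = ∈-bfilter⁻ (inClique w) w

    ∈-c⁻ : ∀ {x} → x ∈ c → x ∈ w × inClique w x ≡ false
    ∈-c⁻ {x} x∈ with ∈-bfilter⁻ (not ∘ inClique w) w x∈
    ... | x∈w , not-in with inClique w x
    ...   | false = x∈w , refl
    ...   | true with () ← not-in

    countℕ-w : ∀ {x} → x ∈ w → countℕ x w ≡ r
    countℕ-w x∈ = count≡ w-labelled _ (All.lookup (labels< w-labelled) x∈)

    u-regular : Regular r u
    u-regular x∈ = trans (countℕ-bfilter (inClique w) _ w (proj₂ (∈-u⁻ x∈))) (countℕ-w (proj₁ (∈-u⁻ x∈)))

    length-u : length u ≡ r * μ
    length-u = begin
      length (bfilter (_∈ᵇ S) w)   ≡⟨ length-bfilter-∈ᵇ S w Unique-S (count≡ w-labelled _ ∘ All.lookup S<n) ⟩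
      length S * r                 ≡⟨ cong (_* r) length-S ⟩
      μ * r                        ≡⟨ *-comm μ r ⟩
      r * μ                        ∎
      where open ≡-Reasoning

    #labels-u : #labels u ≡ μ
    #labels-u = #labels-regular u length-u u-regular

    normalize-u-isMatching : isMatching r μ (normalize u) ≡ true
    normalize-u-isMatching = normalize-isMatching u length-u u-regular

    normalize-u-isClique : isClique P μ (normalize u) ≡ true
    normalize-u-isClique = allPairs-true⇐ _ (upTo μ) (upTo⁺ μ) λ i∈ j∈ i≢j →
      pattern-in-P (subst (_ <_) (sym #labels-u) (∈-upTo⁻ i∈)) (subst (_ <_) (sym #labels-u) (∈-upTo⁻ j∈)) i≢j
      where
      edge∈S : ∀ {i} → i < #labels u → unrank u i ∈ S
      edge∈S i< = does-true (_ ∈? S) (proj₂ (∈-u⁻ (unrank-∈ u i<)))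
      same-pattern : ∀ {i j} → i < #labels u → j < #labels u →
        pattern2 (normalize u) i j ≡ pattern2 w (unrank u i) (unrank u j)
      same-pattern {i} {j} i< j< = begin
        pattern2 (normalize u) i j
          ≡⟨ cong₂ (pattern2 (normalize u)) (rank-unrank u i<) (rank-unrank u j<) ⟨
        pattern2 (map (rank u) u) (rank u (unrank u i)) (rank u (unrank u j))
          ≡⟨ pattern2-map (rank u) u (rank-injective u) (unrank-∈ u i<) (unrank-∈ u j<) ⟩
        pattern2 u (unrank u i) (unrank u j)
          ≡⟨ pattern2-bfilter (inClique w) w _ _ (proj₂ (∈-u⁻ (unrank-∈ u i<))) (proj₂ (∈-u⁻ (unrank-∈ u j<))) ⟩
        pattern2 w (unrank u i) (unrank u j) ∎
        where open ≡-Reasoning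
      pattern-in-P : ∀ {i j} → i < #labels u → j < #labels u → i ≢ j → P (pattern2 (normalize u) i j) ≡ true
      pattern-in-P {i} {j} i< j< i≢j
        with allPairs-true⇒ _ S (proj₂ S-size-clique) (edge∈S i<) (edge∈S j<) (i≢j ∘ unrank-injective u i< j<)
      ... | inj₁ Pij = trans (cong P (same-pattern i< j<)) Pij
      ... | inj₂ Pji = trans (cong P (trans (same-pattern i< j<) (pattern2-sym w _ _))) Pji

    u-fits : length u ≡ #true b
    u-fits = length-bfilter-#true (inClique w) w

    c-fits : length c ≡ #false b
    c-fits = length-bfilter-#false (inClique w) w

    u-c-disjoint : ∀ {x} → x ∈ u → x ∉ c
    u-c-disjoint x∈u x∈c with () ← trans (sym (proj₂ (∈-u⁻ x∈u))) (proj₂ (∈-c⁻ x∈c))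

    w-from-parts : normalize (interleave b u c) ≡ w
    w-from-parts = trans (cong normalize (interleave-bfilter (inClique w) w)) (normalize-rg w rg-w)

    trace-u∈words : trace (normalize u) ∈ words (suc r) (r * μ)
    trace-u∈words = subst (λ L → trace (normalize u) ∈ words (suc r) L) (trans (length-map (rank u) u) length-u)
      (trace∈words (normalize u) normalized-regular)
      where
      normalized-regular : Regular r (normalize u)
      normalized-regular j∈ = normalize-regular u u-regular _ (All.lookup (normalize-< u) j∈)

  module Spliced (w : List ℕ) (hw : HasClique w) (y : List ℕ) (hy : IsLabelledMatching r μ y) where

    open Clique w hw public

    z : List ℕ
    z = splice w y
    shifted : List ℕ
    shifted = map (n +_) y
    ℓ : List ℕ
    ℓ = newLabels w y

    shifted-fits : length shifted ≡ #true b
    shifted-fits = trans (length-map (n +_) y) (trans (length≡ hy) (trans (sym length-u) u-fits))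

    c<n : ∀ {x} → x ∈ c → x < n
    c<n x∈ = All.lookup (labels< w-labelled) (proj₁ (∈-c⁻ x∈))

    shifted∉c : ∀ j → n + j ∉ c
    shifted∉c j x∈ = m+n≮m n j (c<n x∈)

    small∉shifted : ∀ {x} → x < n → x ∉ shifted
    small∉shifted x<n x∈ with j , _ , refl ← ∈-map⁻ (n +_) x∈ = m+n≮m n j x<n

    countℕ-z : ∀ x → countℕ x z ≡ countℕ x shifted + countℕ x c
    countℕ-z x = countℕ-interleave x b shifted c shifted-fits c-fits

    countℕ-z-new : ∀ {j} → j < μ → countℕ (n + j) z ≡ r
    countℕ-z-new {j} j<μ = begin
      countℕ (n + j) z                              ≡⟨ countℕ-z (n + j) ⟩
      countℕ (n + j) shifted + countℕ (n + j) c     ≡⟨ cong₂ _+_ (countℕ-map (n +_) j y (λ _ → +-cancelˡ-≡ n _ _))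
                                                                 (countℕ-∉ (n + j) c (shifted∉c j)) ⟩
      countℕ j y + 0                                ≡⟨ +-identityʳ _ ⟩
      countℕ j y                                    ≡⟨ count≡ hy j j<μ ⟩
      r                                             ∎
      where open ≡-Reasoning

    countℕ-z-old : ∀ {x} → x ∈ c → countℕ x z ≡ r
    countℕ-z-old {x} x∈ = begin
      countℕ x z                       ≡⟨ countℕ-z x ⟩
      countℕ x shifted + countℕ x c    ≡⟨ cong (_+ countℕ x c) (countℕ-∉ x shifted (small∉shifted (c<n x∈))) ⟩
      countℕ x c                       ≡⟨ countℕ-bfilter (not ∘ inClique w) x w (cong not (proj₂ (∈-c⁻ x∈))) ⟩
      countℕ x w                       ≡⟨ countℕ-w (proj₁ (∈-c⁻ x∈)) ⟩
      r                                ∎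
      where open ≡-Reasoning

    z-regular : Regular r z
    z-regular x∈ with ∈-interleave⁻ b shifted c x∈
    ... | inj₂ x∈c = countℕ-z-old x∈c
    ... | inj₁ x∈shifted with j , j∈ , refl ← ∈-map⁻ (n +_) x∈shifted = countℕ-z-new (All.lookup (labels< hy) j∈)

    length-z : length z ≡ r * n
    length-z = trans (length-interleave b shifted c shifted-fits c-fits) (trans (length-map (inClique w) w) (length≡ w-labelled))

    #labels-z : #labels z ≡ n
    #labels-z = #labels-regular z length-z z-regular

    positive-count⇒∈z : ∀ {x} → countℕ x z ≡ r → x ∈ z
    positive-count⇒∈z {x} cnt = countℕ>0⇒∈ x z (subst (0 <_) (sym cnt) (>-nonZero⁻¹ r))

    new∈z : ∀ {j} → j < μ → n + j ∈ z
    new∈z = positive-count⇒∈z ∘ countℕ-z-new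

    c⊆z : c ⊆ z
    c⊆z = positive-count⇒∈z ∘ countℕ-z-old

    newLabel-injective : ∀ {j j′} → j < μ → j′ < μ → rank z (n + j) ≡ rank z (n + j′) → j ≡ j′
    newLabel-injective j< j′< eq = +-cancelˡ-≡ n _ _ (rank-injective z (new∈z j<) (new∈z j′<) eq)

    encode∈Codes : encode (w , y) ∈ Codes
    encode∈Codes = ∈-cartesianProduct⁺ (∈-matchings⁺ r n (normalize z) (normalize-isMatching z length-z z-regular))
      (∈-cartesianProduct⁺ ℓ∈words trace-u∈words)
      where
      ℓ< : ∀ {v} → v ∈ ℓ → v < n
      ℓ< v∈ with j , j∈ , refl ← ∈-map⁻ _ v∈ = subst (rank z (n + j) <_) #labels-z (rank-< z (new∈z (∈-upTo⁻ j∈)))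
      ℓ∈words : ℓ ∈ words n μ
      ℓ∈words = subst (λ L → ℓ ∈ words n L) (trans (length-map _ (upTo μ)) (length-upTo μ))
        (∈-words n ℓ (All.tabulate ℓ<))

    mask-from-code : map (_∈ᵇ ℓ) (normalize z) ≡ b
    mask-from-code = trans (sym (map-∘ z)) (map-interleave-mask _ b shifted c shifted-fits c-fits new-in old-out)
      where
      new-in : ∀ {x} → x ∈ shifted → (rank z x ∈ᵇ ℓ) ≡ true
      new-in x∈ with j , j∈ , refl ← ∈-map⁻ (n +_) x∈ =
        dec-true (_ ∈? ℓ) (∈-map⁺ (λ j → rank z (n + j)) (∈-upTo⁺ (All.lookup (labels< hy) j∈)))
      old-out : ∀ {x} → x ∈ c → (rank z x ∈ᵇ ℓ) ≡ false
      old-out {x} x∈ = dec-false (_ ∈? ℓ) λ rx∈ℓ → case (∈-map⁻ _ rx∈ℓ)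
        where
        case : ¬ ∃ λ j → j ∈ upTo μ × rank z x ≡ rank z (n + j)
        case (j , j∈ , eq) = shifted∉c j (subst (_∈ c) (rank-injective z (c⊆z x∈) (new∈z (∈-upTo⁻ j∈)) eq) x∈)

    private
      normalize-z-parts : normalize z ≡ interleave b (map (rank z) shifted) (map (rank z) c)
      normalize-z-parts = map-interleave (rank z) b shifted c
      shifted-fits′ : length (map (rank z) shifted) ≡ #true b
      shifted-fits′ = trans (length-map _ shifted) shifted-fits
      c-fits′ : length (map (rank z) c) ≡ #false b
      c-fits′ = trans (length-map _ c) c-fits

    keepTrue-code : keepTrue b (normalize z) ≡ map (rank z) shifted
    keepTrue-code = trans (cong (keepTrue b) normalize-z-parts) (keepTrue-interleave b _ _ shifted-fits′ c-fits′)

    keepFalse-code : normalize (keepFalse b (normalize z)) ≡ normalize c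
    keepFalse-code = begin
      normalize (keepFalse b (normalize z))   ≡⟨ cong (normalize ∘ keepFalse b) normalize-z-parts ⟩
      normalize (keepFalse b (interleave b (map (rank z) shifted) (map (rank z) c)))
        ≡⟨ cong normalize (keepFalse-interleave b _ _ shifted-fits′ c-fits′) ⟩
      normalize (map (rank z) c)              ≡⟨ normalize-map (rank z) c (λ p q → rank-injective z (c⊆z p) (c⊆z q)) ⟩
      normalize c                             ∎
      where open ≡-Reasoning

  encode-injective : ∀ {w₁ y₁ w₂ y₂} (hw₁ : HasClique w₁) (hy₁ : IsLabelledMatching r μ y₁)
    (hw₂ : HasClique w₂) (hy₂ : IsLabelledMatching r μ y₂) →
    encode (w₁ , y₁) ≡ encode (w₂ , y₂) → (w₁ , y₁) ≡ (w₂ , y₂)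
  encode-injective {w₁} {y₁} {w₂} {y₂} hw₁ hy₁ hw₂ hy₂ eq = cong₂ _,_ same-w same-y
    where
    open ≡-Reasoning
    module A = Spliced w₁ hw₁ y₁ hy₁
    module B = Spliced w₂ hw₂ y₂ hy₂
    same-z : normalize A.z ≡ normalize B.z
    same-z = cong proj₁ eq
    same-ℓ : A.ℓ ≡ B.ℓ
    same-ℓ = cong (proj₁ ∘ proj₂) eq
    same-mask : A.b ≡ B.b
    same-mask = begin
      A.b                              ≡⟨ A.mask-from-code ⟨
      map (_∈ᵇ A.ℓ) (normalize A.z)    ≡⟨ cong₂ (λ ℓ v → map (_∈ᵇ ℓ) v) same-ℓ same-z ⟩
      map (_∈ᵇ B.ℓ) (normalize B.z)    ≡⟨ B.mask-from-code ⟩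
      B.b                              ∎
    same-y : y₁ ≡ y₂
    same-y = map-cancel-< μ _ _ (λ j j< → map-≡⇒pointwise _ _ (upTo μ) same-ℓ (∈-upTo⁺ j<)) B.newLabel-injective
      (labels< hy₁) (labels< hy₂) (begin
        map (rank A.z ∘ (n +_)) y₁       ≡⟨ map-∘ y₁ ⟩
        map (rank A.z) A.shifted         ≡⟨ A.keepTrue-code ⟨
        keepTrue A.b (normalize A.z)     ≡⟨ cong₂ keepTrue same-mask same-z ⟩
        keepTrue B.b (normalize B.z)     ≡⟨ B.keepTrue-code ⟩
        map (rank B.z) B.shifted         ≡⟨ map-∘ y₂ ⟨
        map (rank B.z ∘ (n +_)) y₂       ∎)
    same-rest : normalize A.c ≡ normalize B.c
    same-rest = begin
      normalize A.c                                  ≡⟨ A.keepFalse-code ⟨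
      normalize (keepFalse A.b (normalize A.z))      ≡⟨ cong₂ (λ m v → normalize (keepFalse m v)) same-mask same-z ⟩
      normalize (keepFalse B.b (normalize B.z))      ≡⟨ B.keepFalse-code ⟩
      normalize B.c                                  ∎
    same-clique : normalize A.u ≡ normalize B.u
    same-clique = rec μ _ _ A.normalize-u-isMatching B.normalize-u-isMatching
                            A.normalize-u-isClique B.normalize-u-isClique (cong (proj₂ ∘ proj₂) eq)
    same-w : w₁ ≡ w₂
    same-w = begin
      w₁                                   ≡⟨ A.w-from-parts ⟨
      normalize (interleave A.b A.u A.c)   ≡⟨ normalize-interleave-cong A.b A.u A.c B.u B.c A.u-fits A.c-fits
                                                (trans B.u-fits (cong #true (sym same-mask)))
                                                (trans B.c-fits (cong #false (sym same-mask)))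
                                                A.u-c-disjoint B.u-c-disjoint same-clique same-rest ⟩
      normalize (interleave A.b B.u B.c)   ≡⟨ cong (λ m → normalize (interleave m B.u B.c)) same-mask ⟩
      normalize (interleave B.b B.u B.c)   ≡⟨ B.w-from-parts ⟩
      w₂                                   ∎

  length-Codes : length Codes ≡ total r n * (n ^ μ * suc r ^ (r * μ))
  length-Codes = begin
    length Codes
      ≡⟨ length-cartesianProductWith _,_ (matchings r n) _ ⟩
    total r n * length (cartesianProduct (words n μ) (words (suc r) (r * μ)))
      ≡⟨ cong (total r n *_) (length-cartesianProductWith _,_ (words n μ) _) ⟩
    total r n * (length (words n μ) * length (words (suc r) (r * μ)))
      ≡⟨ cong (total r n *_) (cong₂ _*_ (length-words n μ) (length-words (suc r) (r * μ))) ⟩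
    total r n * (n ^ μ * suc r ^ (r * μ)) ∎
    where open ≡-Reasoning

  resampling-bound : ∀ {Ws Ys} → Unique Ws → Unique Ys → (∀ {w} → w ∈ Ws → HasClique w) →
    (∀ {y} → y ∈ Ys → IsLabelledMatching r μ y) →
    length Ws * length Ys ≤ total r n * (n ^ μ * suc r ^ (r * μ))
  resampling-bound {Ws} {Ys} uW uY hW hY = begin
    length Ws * length Ys               ≡⟨ length-cartesianProductWith _,_ Ws Ys ⟨
    length (cartesianProduct Ws Ys)     ≤⟨ injectiveOn⇒length≤ encode (cartesianProduct⁺ uW uY) into injective ⟩
    length Codes                        ≡⟨ length-Codes ⟩
    total r n * (n ^ μ * suc r ^ (r * μ)) ∎
    where
    open ≤-Reasoning
    into : ∀ {p} → p ∈ cartesianProduct Ws Ys → encode p ∈ Codes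
    into p∈ with w∈ , y∈ ← ∈-cartesianProduct⁻ Ws Ys p∈ = Spliced.encode∈Codes _ (hW w∈) _ (hY y∈)
    injective : InjectiveOn encode (cartesianProduct Ws Ys)
    injective p∈ q∈ with w∈ , y∈ ← ∈-cartesianProduct⁻ Ws Ys p∈ | w′∈ , y′∈ ← ∈-cartesianProduct⁻ Ws Ys q∈ =
      encode-injective (hW w∈) (hY y∈) (hW w′∈) (hY y′∈)

IsLabelledMatching-++ : ∀ {s t m p q} → IsLabelledMatching s m p → IsLabelledMatching t m q →
  IsLabelledMatching (s + t) m (p ++ q)
IsLabelledMatching-++ {s} {t} {m} {p} {q} hp hq = record
  { length≡ = trans (length-++ p) (trans (cong₂ _+_ (length≡ hp) (length≡ hq)) (sym (*-distribʳ-+ m s t)))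
  ; labels< = All++⁺ (labels< hp) (labels< hq)
  ; count≡ = λ j j<m → trans (countℕ-++ j p q) (cong₂ _+_ (count≡ hp j j<m) (count≡ hq j j<m))
  }

++-injective-≡length : ∀ (p p′ q q′ : List ℕ) → length p ≡ length p′ → p ++ q ≡ p′ ++ q′ →
  p ≡ p′ × q ≡ q′
++-injective-≡length [] [] q q′ _ eq = refl , eq
++-injective-≡length (x ∷ p) (x′ ∷ p′) q q′ len eq
  with refl ← ∷-injectiveˡ eq | refl , refl ← ++-injective-≡length p p′ q q′ (suc-injective len) (∷-injectiveʳ eq) =
  refl , refl

insertAt : ℕ → ℕ → List ℕ → List ℕ
insertAt zero x p = x ∷ p
insertAt (suc i) x [] = x ∷ []
insertAt (suc i) x (y ∷ p) = y ∷ insertAt i x p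

∈-insertAt⁻ : ∀ i x p {z} → z ∈ insertAt i x p → z ≡ x ⊎ z ∈ p
∈-insertAt⁻ zero x p (here e) = inj₁ e
∈-insertAt⁻ zero x p (there z∈) = inj₂ z∈
∈-insertAt⁻ (suc i) x [] (here e) = inj₁ e
∈-insertAt⁻ (suc i) x (y ∷ p) (here e) = inj₂ (here e)
∈-insertAt⁻ (suc i) x (y ∷ p) (there z∈) = [ inj₁ , inj₂ ∘ there ]′ (∈-insertAt⁻ i x p z∈)

countℕ-insertAt : ∀ j i x p → countℕ j (insertAt i x p) ≡ countℕ j (x ∷ p)
countℕ-insertAt j zero x p = refl
countℕ-insertAt j (suc i) x [] = refl
countℕ-insertAt j (suc i) x (y ∷ p) with j ≡ᵇ y | j ≡ᵇ x | countℕ-insertAt j i x p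
... | true | true | ih = cong suc ih
... | true | false | ih = cong suc ih
... | false | true | ih = ih
... | false | false | ih = ih

insertAt-injective : ∀ i i′ x p p′ → x ∉ p → x ∉ p′ → i ≤ length p → i′ ≤ length p′ →
  insertAt i x p ≡ insertAt i′ x p′ → p ≡ p′ × i ≡ i′
insertAt-injective zero zero x p p′ _ _ _ _ refl = refl , refl
insertAt-injective zero (suc i′) x p (y ∷ p′) _ x∉p′ _ _ refl = ⊥-elim (x∉p′ (here refl))
insertAt-injective (suc i) zero x (y ∷ p) p′ x∉p _ _ _ refl = ⊥-elim (x∉p (here refl))
insertAt-injective (suc i) (suc i′) x (y ∷ p) (y′ ∷ p′) x∉p x∉p′ (s≤s i≤) (s≤s i′≤) eq
  with refl ← ∷-injectiveˡ eq
     | refl , refl ← insertAt-injective i i′ x p p′ (x∉p ∘ there) (x∉p′ ∘ there) i≤ i′≤ (∷-injectiveʳ eq) =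
  refl , refl

IsPermutation : ℕ → List ℕ → Set
IsPermutation = IsLabelledMatching 1

insertAt-isPermutation : ∀ k i {p} → IsPermutation k p → IsPermutation (suc k) (insertAt i k p)
insertAt-isPermutation k i {p} hp = record
  { length≡ = trans (length-insertAt i p) (cong suc (length≡ hp))
  ; labels< = All.tabulate λ z∈ →
      [ (λ { refl → ≤-refl }) , m≤n⇒m≤1+n ∘ All.lookup (labels< hp) ]′ (∈-insertAt⁻ i k p z∈)
  ; count≡ = counts
  }
  where
  length-insertAt : ∀ i p → length (insertAt i k p) ≡ suc (length p)
  length-insertAt zero p = refl
  length-insertAt (suc i) [] = refl
  length-insertAt (suc i) (y ∷ p) = cong suc (length-insertAt i p)
  counts : ∀ j → j < suc k → countℕ j (insertAt i k p) ≡ 1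
  counts j j< rewrite countℕ-insertAt j i k p with m≤n⇒m<n∨m≡n (s≤s⁻¹ j<)
  ... | inj₁ j<k rewrite dec-false (j ≟ k) (<⇒≢ j<k) = count≡ hp j j<k
  ... | inj₂ refl rewrite dec-true (j ≟ j) refl = cong suc (countℕ-∉ j p (λ j∈ → n≮n j (All.lookup (labels< hp) j∈)))

permutations : ℕ → List (List ℕ)
permutations zero = [ [] ]
permutations (suc k) = cartesianProductWith (λ p i → insertAt i k p) (permutations k) (upTo (suc k))

permutations-isPermutation : ∀ k {p} → p ∈ permutations k → IsPermutation k p
permutations-isPermutation zero (here refl) = record { length≡ = refl ; labels< = [] ; count≡ = λ _ () }
permutations-isPermutation (suc k) p∈
  with p′ , i , p′∈ , _ , refl ← ∈-cartesianProductWith⁻ (λ p i → insertAt i k p) (permutations k) (upTo (suc k)) p∈ =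
  insertAt-isPermutation k i (permutations-isPermutation k p′∈)

length-permutations : ∀ k → length (permutations k) ≡ k !
length-permutations zero = refl
length-permutations (suc k) = begin
  length (permutations (suc k))                  ≡⟨ length-cartesianProductWith _ (permutations k) (upTo (suc k)) ⟩
  length (permutations k) * length (upTo (suc k)) ≡⟨ cong₂ _*_ (length-permutations k) (length-upTo (suc k)) ⟩
  k ! * suc k                                    ≡⟨ *-comm (k !) (suc k) ⟩
  suc k !                                        ∎
  where open ≡-Reasoning

Unique-permutations : ∀ k → Unique (permutations k)
Unique-permutations zero = [] ∷ []
Unique-permutations (suc k) = Unique-cartesianProductWith⁺ _ (Unique-permutations k) (upTo⁺ (suc k)) injective
  where
  k∉ : ∀ {p} → p ∈ permutations k → k ∉ p
  k∉ p∈ k∈ = n≮n k (All.lookup (labels< (permutations-isPermutation k p∈)) k∈)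
  slot≤ : ∀ {p i} → p ∈ permutations k → i ∈ upTo (suc k) → i ≤ length p
  slot≤ p∈ i∈ = subst (_ ≤_) (sym (trans (length≡ (permutations-isPermutation k p∈)) (*-identityˡ k)))
    (s≤s⁻¹ (∈-upTo⁻ i∈))
  injective : ∀ {p p′ i i′} → p ∈ permutations k → p′ ∈ permutations k → i ∈ upTo (suc k) → i′ ∈ upTo (suc k) →
    insertAt i k p ≡ insertAt i′ k p′ → p ≡ p′ × i ≡ i′
  injective p∈ p′∈ i∈ i′∈ =
    insertAt-injective _ _ k _ _ (k∉ p∈) (k∉ p′∈) (slot≤ p∈ i∈) (slot≤ p′∈ i′∈)

permutationBlocks : ℕ → ℕ → List (List ℕ)
permutationBlocks μ zero = [ [] ]
permutationBlocks μ (suc i) = cartesianProductWith _++_ (permutations μ) (permutationBlocks μ i)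

length-permutationBlocks : ∀ μ i → length (permutationBlocks μ i) ≡ (μ !) ^ i
length-permutationBlocks μ zero = refl
length-permutationBlocks μ (suc i) =
  trans (length-cartesianProductWith _++_ (permutations μ) (permutationBlocks μ i))
        (cong₂ _*_ (length-permutations μ) (length-permutationBlocks μ i))

permutationBlocks-isLabelledMatching : ∀ μ i {y} → y ∈ permutationBlocks μ i → IsLabelledMatching i μ y
permutationBlocks-isLabelledMatching μ zero (here refl) = record { length≡ = refl ; labels< = [] ; count≡ = λ _ _ → refl }
permutationBlocks-isLabelledMatching μ (suc i) y∈
  with p , y′ , p∈ , y′∈ , refl ← ∈-cartesianProductWith⁻ _++_ (permutations μ) (permutationBlocks μ i) y∈ =
  IsLabelledMatching-++ (permutations-isPermutation μ p∈) (permutationBlocks-isLabelledMatching μ i y′∈)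

Unique-permutationBlocks : ∀ μ i → Unique (permutationBlocks μ i)
Unique-permutationBlocks μ zero = [] ∷ []
Unique-permutationBlocks μ (suc i) = Unique-cartesianProductWith⁺ _++_ (Unique-permutations μ) (Unique-permutationBlocks μ i)
  λ p∈ p′∈ _ _ → ++-injective-≡length _ _ _ _
    (trans (length≡ (permutations-isPermutation μ p∈)) (sym (length≡ (permutations-isPermutation μ p′∈))))

[m*n]^k≡m^k*n^k : ∀ m n k → (m * n) ^ k ≡ m ^ k * n ^ k
[m*n]^k≡m^k*n^k m n zero = refl
[m*n]^k≡m^k*n^k m n (suc k) rewrite [m*n]^k≡m^k*n^k m n k =
  solve 4 (λ m n x y → (m :* n) :* (x :* y) := (m :* x) :* (n :* y)) refl m n (m ^ k) (n ^ k)
  where open +-*-Solver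

n<2^n : ∀ n → n < 2 ^ n
n<2^n zero = s≤s z≤n
n<2^n (suc n) = begin-strict
  suc n          <⟨ s≤s (n<2^n n) ⟩
  suc (2 ^ n)    ≤⟨ +-monoˡ-≤ (2 ^ n) (m^n>0 2 n) ⟩
  2 ^ n + 2 ^ n  ≡⟨ cong (2 ^ n +_) (+-identityʳ (2 ^ n)) ⟨
  2 * 2 ^ n      ∎
  where open ≤-Reasoning

-- (1 + 1/a) ^ k ≤ a / (a − k), with d + 1 = a − k.
[1+a]^k*[1+d]≤a^k*a : ∀ k a d → a ≡ k + suc d → suc a ^ k * suc d ≤ a ^ k * a
[1+a]^k*[1+d]≤a^k*a zero a d a≡ = ≤-reflexive (trans (+-identityʳ (suc d)) (trans (sym a≡) (sym (+-identityʳ a))))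
[1+a]^k*[1+d]≤a^k*a (suc k) a d a≡ = begin
  suc a * X * suc d           ≡⟨ solve 3 (λ sa x sd → (sa :* x) :* sd := x :* (sa :* sd)) refl (suc a) X (suc d) ⟩
  X * (suc a * suc d)         ≤⟨ *-monoʳ-≤ X step ⟩
  X * (a * suc (suc d))       ≡⟨ solve 3 (λ x a sd → x :* (a :* sd) := a :* (x :* sd)) refl X a (suc (suc d)) ⟩
  a * (X * suc (suc d))       ≤⟨ *-monoʳ-≤ a ([1+a]^k*[1+d]≤a^k*a k a (suc d) (trans a≡ (sym (+-suc k (suc d))))) ⟩
  a * (a ^ k * a)             ≡⟨ *-assoc a (a ^ k) a ⟨
  a * a ^ k * a               ∎
  where
  open ≤-Reasoning
  open +-*-Solver
  X : ℕ
  X = suc a ^ k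
  d<a : suc d ≤ a
  d<a = subst (suc d ≤_) (sym a≡) (≤-trans (m≤n+m (suc d) k) (n≤1+n _))
  step : suc a * suc d ≤ a * suc (suc d)
  step = begin
    suc a * suc d          ≡⟨ solve 2 (λ a d → (con 1 :+ a) :* (con 1 :+ d) := a :* (con 1 :+ d) :+ (con 1 :+ d)) refl a d ⟩
    a * suc d + suc d      ≤⟨ +-monoʳ-≤ (a * suc d) d<a ⟩
    a * suc d + a          ≡⟨ solve 2 (λ a d → a :* (con 1 :+ d) :+ a := a :* (con 2 :+ d)) refl a d ⟩
    a * suc (suc d)        ∎

[1+2m]^m≤2*[2m]^m : ∀ m → suc (m + m) ^ m ≤ 2 * (m + m) ^ m
[1+2m]^m≤2*[2m]^m zero = s≤s z≤n
[1+2m]^m≤2*[2m]^m (suc d) = *-cancelʳ-≤ _ _ (suc d) (begin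
  suc 2m ^ suc d * suc d    ≤⟨ [1+a]^k*[1+d]≤a^k*a (suc d) 2m d refl ⟩
  2m ^ suc d * 2m
    ≡⟨ solve 2 (λ p d → p :* ((con 1 :+ d) :+ (con 1 :+ d)) := (con 2 :* p) :* (con 1 :+ d)) refl (2m ^ suc d) d ⟩
  2 * 2m ^ suc d * suc d    ∎)
  where
  open ≤-Reasoning
  open +-*-Solver
  2m : ℕ
  2m = suc d + suc d

-- 1 + 1/m ≤ (1 + 1/2m) ^ 2, and (1 + 1/2m) ^ m ≤ 2.
[1+m]^m≤4*m^m : ∀ m → suc m ^ m ≤ 4 * m ^ m
[1+m]^m≤4*m^m zero = s≤s z≤n
[1+m]^m≤4*m^m m@(suc d) = *-cancelʳ-≤ _ _ Q {{Q≢0}} (begin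
  suc m ^ m * Q                        ≡⟨ cong (suc m ^ m *_) ([m*n]^k≡m^k*n^k 2m 2m m) ⟨
  suc m ^ m * (2m * 2m) ^ m            ≡⟨ [m*n]^k≡m^k*n^k (suc m) (2m * 2m) m ⟨
  (suc m * (2m * 2m)) ^ m              ≤⟨ ^-monoˡ-≤ m cubic-bound ⟩
  (suc 2m * suc 2m * m) ^ m
    ≡⟨ trans ([m*n]^k≡m^k*n^k (suc 2m * suc 2m) m m) (cong (_* m ^ m) ([m*n]^k≡m^k*n^k (suc 2m) (suc 2m) m)) ⟩
  suc 2m ^ m * suc 2m ^ m * m ^ m      ≤⟨ *-monoˡ-≤ (m ^ m) (*-mono-≤ ([1+2m]^m≤2*[2m]^m m) ([1+2m]^m≤2*[2m]^m m)) ⟩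
  2 * 2m ^ m * (2 * 2m ^ m) * m ^ m
    ≡⟨ solve 2 (λ x y → (con 2 :* x) :* (con 2 :* x) :* y := (con 4 :* y) :* (x :* x)) refl (2m ^ m) (m ^ m) ⟩
  4 * m ^ m * Q                        ∎)
  where
  open ≤-Reasoning
  open +-*-Solver
  2m : ℕ
  2m = m + m
  Q : ℕ
  Q = 2m ^ m * 2m ^ m
  Q≢0 : NonZero Q
  Q≢0 = m*n≢0 (2m ^ m) (2m ^ m) {{m^n≢0 2m m}} {{m^n≢0 2m m}}
  cubic-bound : suc m * (2m * 2m) ≤ suc 2m * suc 2m * m
  cubic-bound = begin
    suc m * (2m * 2m)          ≤⟨ m≤m+n _ m ⟩
    suc m * (2m * 2m) + m      ≡⟨ solve 1 (λ m → (con 1 :+ m) :* ((m :+ m) :* (m :+ m)) :+ m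
                                               := (con 1 :+ (m :+ m)) :* (con 1 :+ (m :+ m)) :* m) refl m ⟩
    suc 2m * suc 2m * m        ∎

m^m≤4^m*m! : ∀ m → m ^ m ≤ 4 ^ m * m !
m^m≤4^m*m! zero = s≤s z≤n
m^m≤4^m*m! (suc m) = begin
  suc m * suc m ^ m              ≤⟨ *-monoʳ-≤ (suc m) ([1+m]^m≤4*m^m m) ⟩
  suc m * (4 * m ^ m)            ≤⟨ *-monoʳ-≤ (suc m) (*-monoʳ-≤ 4 (m^m≤4^m*m! m)) ⟩
  suc m * (4 * (4 ^ m * m !))
    ≡⟨ solve 3 (λ s p f → s :* (con 4 :* (p :* f)) := (con 4 :* p) :* (s :* f)) refl (suc m) (4 ^ m) (m !) ⟩
  4 * 4 ^ m * (suc m * m !)      ∎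
  where
  open ≤-Reasoning
  open +-*-Solver

-- With E = r μ, (8 (r + 1)) ^ E = 2 ^ E · 4 ^ E · (r + 1) ^ E: the factor 4 ^ E pays for
-- μ ^ μ ≤ 4 ^ μ μ !, and 2 ^ E > μ ^ r > n ≥ k + 1.
[1+k]*n^μ*[1+r]^rμ<[μ!]^r : ∀ r k n μ → .{{NonZero r}} → (8 * suc r) ^ r * n < μ ^ r → suc k ≤ n →
  suc k * (n ^ μ * suc r ^ (r * μ)) < (μ !) ^ r
[1+k]*n^μ*[1+r]^rμ<[μ!]^r r@(suc r′) k n zero small _ rewrite *-zeroˡ (0 ^ r′) with () ← small
[1+k]*n^μ*[1+r]^rμ<[μ!]^r r@(suc _) k n μ@(suc _) small k<n = begin-strict
  suc k * X       ≤⟨ *-monoˡ-≤ X (<⇒≤ k<2^E) ⟩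
  2 ^ E * X       <⟨ *-cancelˡ-< (4 ^ E) (2 ^ E * X) Y key ⟩
  Y               ∎
  where
  open ≤-Reasoning
  open +-*-Solver
  c : ℕ
  c = 8 * suc r
  E : ℕ
  E = r * μ
  X : ℕ
  X = n ^ μ * suc r ^ E
  Y : ℕ
  Y = (μ !) ^ r
  k<2^E : suc k < 2 ^ E
  k<2^E = begin-strict
    suc k        ≤⟨ k<n ⟩
    n            ≤⟨ m≤n*m n (c ^ r) {{m^n≢0 c r}} ⟩
    c ^ r * n    <⟨ small ⟩
    μ ^ r        ≤⟨ ^-monoˡ-≤ r (<⇒≤ (n<2^n μ)) ⟩
    (2 ^ μ) ^ r  ≡⟨ trans (^-*-assoc 2 μ r) (cong (2 ^_) (*-comm μ r)) ⟩
    2 ^ E        ∎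
  c^E : c ^ E ≡ 2 ^ E * 4 ^ E * suc r ^ E
  c^E = trans ([m*n]^k≡m^k*n^k 8 (suc r) E) (cong (_* suc r ^ E) ([m*n]^k≡m^k*n^k 2 4 E))
  key : 4 ^ E * (2 ^ E * X) < 4 ^ E * Y
  key = begin-strict
    4 ^ E * (2 ^ E * X)
      ≡⟨ solve 4 (λ f t a b → f :* (t :* (a :* b)) := ((t :* f) :* b) :* a) refl (4 ^ E) (2 ^ E) (n ^ μ) (suc r ^ E) ⟩
    2 ^ E * 4 ^ E * suc r ^ E * n ^ μ ≡⟨ cong (_* n ^ μ) (trans (sym c^E) (sym (^-*-assoc c r μ))) ⟩
    (c ^ r) ^ μ * n ^ μ               ≡⟨ [m*n]^k≡m^k*n^k (c ^ r) n μ ⟨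
    (c ^ r * n) ^ μ                   <⟨ ^-monoˡ-< μ small ⟩
    (μ ^ r) ^ μ                       ≡⟨ trans (^-*-assoc μ r μ) (trans (cong (μ ^_) (*-comm r μ)) (sym (^-*-assoc μ μ r))) ⟩
    (μ ^ μ) ^ r                       ≤⟨ ^-monoˡ-≤ r (m^m≤4^m*m! μ) ⟩
    (4 ^ μ * μ !) ^ r                 ≡⟨ [m*n]^k≡m^k*n^k (4 ^ μ) (μ !) r ⟩
    (4 ^ μ) ^ r * Y                   ≡⟨ cong (_* Y) (trans (^-*-assoc 4 μ r) (cong (4 ^_) (*-comm μ r))) ⟩
    4 ^ E * Y                         ∎

double-counting-< : ∀ a c T X Y → a * Y ≤ T * X → c * X < Y → 0 < T → c * a < T
double-counting-< a c T X Y aY≤TX cX<Y T>0 = *-cancelʳ-< Y (c * a) T (begin-strict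
  c * a * Y      ≡⟨ *-assoc c a Y ⟩
  c * (a * Y)    ≤⟨ *-monoʳ-≤ c aY≤TX ⟩
  c * (T * X)    ≡⟨ solve 3 (λ c t x → c :* (t :* x) := t :* (c :* x)) refl c T X ⟩
  T * (c * X)    <⟨ *-monoʳ-< T {{>-nonZero T>0}} cX<Y ⟩
  T * Y          ∎)
  where
  open ≤-Reasoning
  open +-*-Solver

searchBaseAbove : ℕ → ℕ → ℕ → ℕ → ℕ
searchBaseAbove K r zero s = s
searchBaseAbove K r (suc fuel) s = if K <ᵇ s ^ r then s else searchBaseAbove K r fuel (suc s)

searchBaseAbove-spec : ∀ K r fuel s → (∀ z → z < s → z ^ r ≤ K) → K < (s + fuel) ^ r →
  K < searchBaseAbove K r fuel s ^ r × (∀ z → z < searchBaseAbove K r fuel s → z ^ r ≤ K)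
searchBaseAbove-spec K r zero s below enough = subst (λ t → K < t ^ r) (+-identityʳ s) enough , below
searchBaseAbove-spec K r (suc fuel) s below enough with K <ᵇ s ^ r in K<s^r
... | true = does-true (K <? s ^ r) K<s^r , below
... | false = searchBaseAbove-spec K r fuel (suc s) below′ (subst (λ t → K < t ^ r) (+-suc s fuel) enough)
  where
  below′ : ∀ z → z < suc s → z ^ r ≤ K
  below′ z z≤s with m≤n⇒m<n∨m≡n (s≤s⁻¹ z≤s)
  ... | inj₁ z<s = below z z<s
  ... | inj₂ refl = ≮⇒≥ (does-false (K <? z ^ r) K<s^r)

leastBaseAbove : ℕ → ℕ → ℕ
leastBaseAbove K r = searchBaseAbove K r (suc K) 0

leastBaseAbove-spec : ∀ K r → .{{NonZero r}} →
  K < leastBaseAbove K r ^ r × (∀ z → K < z ^ r → leastBaseAbove K r ≤ z)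
leastBaseAbove-spec K r@(suc r′)
  with above , least ← searchBaseAbove-spec K r (suc K) 0 (λ _ ())
                          (m≤m*n (suc K) (suc K ^ r′) {{m^n≢0 (suc K) r′}}) =
  above , λ z K<z^r → ≮⇒≥ (λ z<least → <⇒≱ K<z^r (least z z<least))

large-zP⇒clique : ∀ r → .{{NonZero r}} → ∀ P n μ w {K} → (∀ z → K < z ^ r → μ ≤ z) → K < zP P n w ^ r →
  ∃ λ S → S ∈ subs (upTo n) × ((length S ≡ᵇ μ) ∧ isCliqueOn P w S) ≡ true
large-zP⇒clique r P n μ w {K} least K<zP^r
  with foldr-selective ⊔-sel 0 (map length (bfilter (isCliqueOn P w) (subs (upTo n))))
... | inj₁ zP≡0 = ⊥-elim (n≮0 (subst (K <_) (0^r≡0 r) (subst (λ z → K < z ^ r) zP≡0 K<zP^r)))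
  where
  0^r≡0 : ∀ r → .{{NonZero r}} → 0 ^ r ≡ 0
  0^r≡0 (suc _) = refl
... | inj₂ zP∈ with S , S∈ , zP≡ ← ∈-map⁻ length zP∈ = take μ S , take∈subs (upTo n) μ S∈subs , size-and-clique
  where
  S∈subs : S ∈ subs (upTo n)
  S∈subs = proj₁ (∈-bfilter⁻ (isCliqueOn P w) (subs (upTo n)) S∈)
  length-take-μ : length (take μ S) ≡ μ
  length-take-μ = trans (length-take μ S) (m≤n⇒m⊓n≡m (subst (μ ≤_) zP≡ (least _ K<zP^r)))
  size-and-clique : ((length (take μ S) ≡ᵇ μ) ∧ isCliqueOn P w (take μ S)) ≡ true
  size-and-clique rewrite dec-true (length (take μ S) ≟ μ) length-take-μ =
    allPairs-take _ μ S (proj₂ (∈-bfilter⁻ (isCliqueOn P w) (subs (upTo n)) S∈))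

total>0 : ∀ r n → .{{NonZero r}} → 0 < total r n
total>0 r n = ∈-length (∈-matchings⁺ r n (normalize y) (normalize-isMatching y (length≡ hy) y-regular))
  where
  blocks : List (List ℕ)
  blocks = permutationBlocks n r
  y : List ℕ
  y = headOr [] blocks
  hy : IsLabelledMatching r n y
  hy = permutationBlocks-isLabelledMatching n r
         (headOr-∈ [] blocks (subst (0 <_) (sym (length-permutationBlocks n r)) (m^n>0 (n !) {{n !≢0}} r)))
  y-regular : Regular r y
  y-regular x∈ = count≡ hy _ (All.lookup (labels< hy) x∈)

bad-fraction-bound : ∀ r → .{{NonZero r}} → ∀ P → Reconstructible r P → ∀ k n → suc k ≤ n →
  suc k * badCount r P (8 * suc r) n < total r n
bad-fraction-bound r P rec k n k<n =
  double-counting-< (length bad) (suc k) (total r n) (n ^ μ * suc r ^ (r * μ)) ((μ !) ^ r)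
    (subst (λ Y → length bad * Y ≤ total r n * (n ^ μ * suc r ^ (r * μ))) (length-permutationBlocks μ r)
      (resampling-bound (Unique-bfilter isBad (Unique-matchings r n)) (Unique-permutationBlocks μ r)
                        bad⇒clique (permutationBlocks-isLabelledMatching μ r)))
    ([1+k]*n^μ*[1+r]^rμ<[μ!]^r r k n μ K<μ^r k<n)
    (total>0 r n)
  where
  K : ℕ
  K = (8 * suc r) ^ r * n
  μ : ℕ
  μ = leastBaseAbove K r
  K<μ^r : K < μ ^ r
  K<μ^r = proj₁ (leastBaseAbove-spec K r)
  μ-least : ∀ z → K < z ^ r → μ ≤ z
  μ-least = proj₂ (leastBaseAbove-spec K r)
  open CliqueResampling r P rec n μ
  isBad : List ℕ → Bool
  isBad w = K <ᵇ zP P n w ^ r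
  bad : List (List ℕ)
  bad = bfilter isBad (matchings r n)
  bad⇒clique : ∀ {w} → w ∈ bad → HasClique w
  bad⇒clique {w} w∈
    with w∈matchings , w-bad ← ∈-bfilter⁻ isBad (matchings r n) w∈
    with S , S∈ , S-ok ← large-zP⇒clique r P n μ w μ-least (does-true (K <? _) w-bad) =
    ∈-matchings⁻ r n w w∈matchings ,
    headOr-∈ [] (cliquesOfSize w) (∈-length (∈-bfilter⁺ (λ S → (length S ≡ᵇ μ) ∧ isCliqueOn P w S) S∈ S-ok))

mainTheorem6 : (r : ℕ) → 2 ≤ r → (P : PatternSet) → Reconstructible r P →
    Σ ℕ λ C → (0 < C) × AAS-bounded r P C
mainTheorem6 r 2≤r P rec = 8 * suc r , s≤s z≤n , λ k → suc k , bad-fraction-bound r {{r≢0}} P rec k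
  where
  r≢0 : NonZero r
  r≢0 = >-nonZero (≤-trans (s≤s z≤n) 2≤r)
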